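{- Let $m \neq \ell$ with $0\le m,\ell\le n-2$. Then $$ \sum_{\pi \in \mathrm{PPF}_n} q^{ \Delta_{\ell} f(\pi)} F_{n, \mathrm{Set}_{\ell}(\pi)}=\sum_{i=1}^n q^{n-i}(n-2)^{i-1} s_{(i,1^{n-i})},$$ and $$ \sum_{\pi \in \mathrm{PPF}_n} q^{ \Delta_{\ell} f(\pi)} F_{n, \mathrm{Set}_{m}(\pi)}= \sum_{i=1}^n (q+n-3)^{i-1} s_{(i,1^{n-i})}.$$
   Context: A (classical) parking function of length $n$ is a sequence of positive integers whose increasing rearrangement $\lambda$ satisfies $\lambda_i\le i$. A parking function of length $n$ is prime if removing any instance of 1 yields a parking function of length $n-1$; $\mathrm{PPF}_n$ denotes this set. A tuple $(x_1,\dots,x_n)$ has an $\ell$-forward difference at $i\in[n-1]$ if $x_{i+1}-x_i\equiv\ell\pmod{n-1}$; $\Delta_\ell f(\pi)$ is the number of $\ell$-forward differences of $\pi$, and $\mathrm{Set}_\ell(\pi)\subseteq[n-1]$ is the set of indices $i$ at which $\pi$ has an $\ell$-forward difference. For $S\subseteq[n-1]$, $F_{n,S}=\sum_{1\le b_1\le\cdots\le b_n,\ i\in S\Rightarrow b_i<b_{i+1}} x_{b_1}\cdots x_{b_n}$ is Gessel's fundamental quasisymmetric function, and $s_{(i,1^{n-i})}$ is the Schur function of the hook partition $(i,1^{n-i})$. -}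

module Defs where

open import Data.Bool using (Bool; true; false; _∧_; if_then_else_; T?)
open import Data.Nat as ℕ using (ℕ; zero; suc; _≤ᵇ_; _<ᵇ_; _∸_)
open import Data.Nat.Properties using (≤-decTotalOrder)
open import Data.Integer as ℤ using (ℤ; +_; _-_; _^_)
open import Data.Integer.Divisibility.Signed using (_∣?_)
open import Data.List using (List; []; _∷_; map; concatMap; filter; upTo; foldr; zipWith; replicate; length; concat)
open import Relation.Nullary using (does)
open import Data.List.Sort.InsertionSort.Base ≤-decTotalOrder using (sort)

oneTo : ℕ → List ℕ
oneTo k = map suc (upTo k)

seqs : ℕ → ℕ → List (List ℕ)
seqs zero    k = [] ∷ []
seqs (suc l) k = concatMap (λ a → map (a ∷_) (seqs l k)) (oneTo k)

sumℤ : List ℤ → ℤ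
sumℤ = foldr ℤ._+_ (+ 0)

prodℤ : List ℤ → ℤ
prodℤ = foldr ℤ._*_ (+ 1)

mono : (ℕ → ℤ) → List ℕ → ℤ
mono x b = prodℤ (map x b)

allB : {A : Set} → (A → Bool) → List A → Bool
allB p = foldr (λ a r → p a ∧ r) true

count : List Bool → ℕ
count = foldr (λ b c → if b then suc c else c) 0

-- check λ_i ≤ i for i = j, j+1, … (1-based positions)
boundedFrom : ℕ → List ℕ → Bool
boundedFrom j []       = true
boundedFrom j (a ∷ as) = (a ≤ᵇ j) ∧ boundedFrom (suc j) as

isPF : List ℕ → Bool
isPF π = allB (λ a → 1 ≤ᵇ a) π ∧ boundedFrom 1 (sort π)

-- remove the entry at (0-based) position j
removeAt : List ℕ → ℕ → List ℕ
removeAt []       j       = []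
removeAt (a ∷ as) zero    = as
removeAt (a ∷ as) (suc j) = a ∷ removeAt as j

onesPos : ℕ → List ℕ → List ℕ
onesPos j []       = []
onesPos j (a ∷ as) = if a ℕ.≡ᵇ 1 then j ∷ onesPos (suc j) as else onesPos (suc j) as

isPPF : List ℕ → Bool
isPPF π = isPF π ∧ allB (λ j → isPF (removeAt π j)) (onesPos 0 π)

-- PPF_n (every parking function of length n has entries in {1,…,n})
PPF : ℕ → List (List ℕ)
PPF n = filter (λ π → T? (isPPF π)) (seqs n n)

-- Forward differences (positions i ∈ [n-1], as a characteristic list
-- of length n-1 whose (i-1)-th entry says whether i is in the set)

fwdDiff : ℕ → ℕ → ℕ → ℕ → Bool
fwdDiff n ℓ a b = does ((+ (n ∸ 1)) ∣? ((+ b - + a) - + ℓ))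

diffList : ℕ → ℕ → List ℕ → List Bool
diffList n ℓ []           = []
diffList n ℓ (a ∷ [])     = []
diffList n ℓ (a ∷ b ∷ as) = fwdDiff n ℓ a b ∷ diffList n ℓ (b ∷ as)

Set[_] : ℕ → ℕ → List ℕ → List Bool
Set[ n ] ℓ π = diffList n ℓ π

Δf : ℕ → ℕ → List ℕ → ℕ
Δf n ℓ π = count (diffList n ℓ π)

-- Gessel's fundamental quasisymmetric function F_{n,S}, evaluated in the
-- N variables x_1,…,x_N (given by x : ℕ → ℤ).  S ⊆ [n-1] is a
-- characteristic list.

admissible : List Bool → List ℕ → Bool
admissible S        []           = true
admissible S        (a ∷ [])     = true
admissible []       (a ∷ b ∷ bs) = (a ≤ᵇ b) ∧ admissible [] (b ∷ bs)
admissible (s ∷ S)  (a ∷ b ∷ bs) =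
  (if s then a <ᵇ b else a ≤ᵇ b) ∧ admissible S (b ∷ bs)

F : ℕ → List Bool → ℕ → (ℕ → ℤ) → ℤ
F n S N x = sumℤ (map (mono x) (filter (λ b → T? (admissible S b)) (seqs n N)))

-- Schur functions s_λ = Σ_{T SSYT of shape λ} x^T, evaluated in N variables.
-- A partition is the list of its row lengths (weakly decreasing).

weaklyInc : List ℕ → Bool
weaklyInc []           = true
weaklyInc (a ∷ [])     = true
weaklyInc (a ∷ b ∷ bs) = (a ≤ᵇ b) ∧ weaklyInc (b ∷ bs)

colsStrict : List (List ℕ) → Bool
colsStrict []             = true
colsStrict (r ∷ [])       = true
colsStrict (r ∷ r′ ∷ rs)  = allB (λ b → b) (zipWith _<ᵇ_ r r′) ∧ colsStrict (r′ ∷ rs)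

isSSYT : List (List ℕ) → Bool
isSSYT T = allB weaklyInc T ∧ colsStrict T

fillings : List ℕ → ℕ → List (List (List ℕ))
fillings []       N = [] ∷ []
fillings (l ∷ ls) N = concatMap (λ r → map (r ∷_) (fillings ls N)) (seqs l N)

schur : List ℕ → ℕ → (ℕ → ℤ) → ℤ
schur λp N x = sumℤ (map (λ T → mono x (concat T)) (filter (λ T → T? (isSSYT T)) (fillings λp N)))

hook : ℕ → ℕ → List ℕ
hook n i = i ∷ replicate (n ∸ i) 1

sumOneTo : ℕ → (ℕ → ℤ) → ℤ
sumOneTo n f = sumℤ (map f (oneTo n))

{-# OPTIONS --safe #-}
-- Let M = n − 1. The entries of a prime parking function of length n lie in [1, M], so it is
-- determined by its first entry and its forward differences d ∈ [0, M)^M modulo M, and both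
-- Δ_ℓ f and Set_k depend on d alone. By the cycle lemma, for every d exactly one of the M possible
-- first entries yields a prime parking function, so the sum over PPF_n becomes a sum over all d.
-- Summing over d one position at a time turns Σ_d q^{#{i : d_i = ℓ}} F_{n,{i : d_i = k}} into
-- Σ_b x^b ∏_i (β[b_i ≤ b_{i+1}] + γ[b_i < b_{i+1}]), where (β, γ) = (n − 2, q) if k = ℓ and
-- (q + n − 3, 1) if k ≠ ℓ. A hook tableau is a weakly increasing row and a strictly increasing
-- column sharing their corner t. With the first letter t fixed, the weighted sum above and
-- Σ_j β^j γ^{n−1−j} (rows of length j + 1) (columns of length n − j) satisfy the same downward
-- recursion in t, and summing over t gives Σ_i γ^{n−i} β^{i−1} s_{(i,1^{n−i})}.
module Submission where

open import Defs
open import Data.Bool using (Bool; true; false; T; T?; if_then_else_; _∧_)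
import Data.Bool.Properties as Boolₚ
open import Data.Empty using (⊥-elim)
open import Data.Nat as ℕ
  using (ℕ; zero; suc; _≤_; _<_; z≤n; s≤s; _≤ᵇ_; _<ᵇ_; _≡ᵇ_; _∸_; _≤?_; _<?_; NonZero)
import Data.Nat.Properties as ℕₚ
import Data.Nat.Divisibility as ℕ∣
open import Data.Nat.DivMod
  using (_%_; _/_; m%n<n; m<n⇒m%n≡m; %-distribˡ-+; m%n%n≡m%n; [m+n]%n≡m%n; m≡m%n+[m/n]*n)
open import Data.List
  using (List; []; _∷_; [_]; map; length; upTo; applyUpTo; filter; concatMap; _++_; concat; replicate; zipWith)
import Data.List.Properties as Listₚ
open import Data.List.Relation.Unary.All as All using (All; []; _∷_)
open import Data.List.Relation.Unary.All.Properties using (map⁺)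
open import Data.Product using (∃; _×_; _,_; proj₁; proj₂)
open import Data.Sum using (inj₁; inj₂)
open import Relation.Binary.Definitions using (tri<; tri≈; tri>)
open import Relation.Binary.PropositionalEquality
  using (_≡_; _≢_; refl; sym; trans; cong; cong₂; subst; subst₂; module ≡-Reasoning)
open import Relation.Nullary using (¬_; yes; no)
open import Relation.Nullary.Decidable using (dec-true; dec-false)
open import Data.Integer using (ℤ)
import Data.Integer.Properties as ℤₚ
open import Data.Integer.Divisibility.Signed
  using (_∣_; divides; _∣?_; ∣⇒∣ᵤ; ∣-refl; ∣m∣n⇒∣m+n; ∣m+n∣n⇒∣m; ∣n⇒∣m*n)

T⇒≡true : ∀ {b} → T b → b ≡ true
T⇒≡true {true} _ = refl

¬T⇒≡false : ∀ {b} → ¬ T b → b ≡ false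
¬T⇒≡false {true} ¬t = ⊥-elim (¬t _)
¬T⇒≡false {false} _ = refl

<ᵇ≡true : ∀ {m n} → m < n → (m <ᵇ n) ≡ true
<ᵇ≡true m<n = T⇒≡true (ℕₚ.<⇒<ᵇ m<n)

<ᵇ≡false : ∀ {m n} → n ≤ m → (m <ᵇ n) ≡ false
<ᵇ≡false {m} {n} n≤m = ¬T⇒≡false (λ t → ℕₚ.<⇒≱ (ℕₚ.<ᵇ⇒< m n t) n≤m)

≤ᵇ≡true : ∀ {m n} → m ≤ n → (m ≤ᵇ n) ≡ true
≤ᵇ≡true m≤n = T⇒≡true (ℕₚ.≤⇒≤ᵇ m≤n)

≤ᵇ≡false : ∀ {m n} → n < m → (m ≤ᵇ n) ≡ false
≤ᵇ≡false {m} {n} n<m = ¬T⇒≡false (λ t → ℕₚ.<⇒≱ n<m (ℕₚ.≤ᵇ⇒≤ m n t))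

≡ᵇ-refl : ∀ m → (m ≡ᵇ m) ≡ true
≡ᵇ-refl m = T⇒≡true (ℕₚ.≡⇒≡ᵇ m m refl)

≡ᵇ≡false : ∀ {m n} → m ≢ n → (m ≡ᵇ n) ≡ false
≡ᵇ≡false {m} {n} m≢n = ¬T⇒≡false (λ t → m≢n (ℕₚ.≡ᵇ⇒≡ m n t))

≤ᵇ≡true⇒≤ : ∀ {m n} → (m ≤ᵇ n) ≡ true → m ≤ n
≤ᵇ≡true⇒≤ {m} {n} e = ℕₚ.≤ᵇ⇒≤ m n (subst T (sym e) _)

≡ᵇ≡true⇒≡ : ∀ {m n} → (m ≡ᵇ n) ≡ true → m ≡ n
≡ᵇ≡true⇒≡ {m} {n} e = ℕₚ.≡ᵇ⇒≡ m n (subst T (sym e) _)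

∧≡true⁻ : ∀ {a b} → a ∧ b ≡ true → a ≡ true × b ≡ true
∧≡true⁻ {true} {true} _ = refl , refl

∧≡true⁺ : ∀ {a b} → a ≡ true → b ≡ true → a ∧ b ≡ true
∧≡true⁺ refl refl = refl

allB≡true⇒All : ∀ {A : Set} (p : A → Bool) l → allB p l ≡ true → All (λ a → p a ≡ true) l
allB≡true⇒All p [] _ = []
allB≡true⇒All p (a ∷ l) h with pa , pl ← ∧≡true⁻ {p a} h = pa ∷ allB≡true⇒All p l pl

All⇒allB≡true : ∀ {A : Set} (p : A → Bool) l → All (λ a → p a ≡ true) l → allB p l ≡ true
All⇒allB≡true p [] [] = refl
All⇒allB≡true p (a ∷ l) (pa ∷ pl) = ∧≡true⁺ pa (All⇒allB≡true p l pl)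

record IsLastMinimum (f : ℕ → ℕ) (K u : ℕ) : Set where
  constructor lastMinimum
  field
    1≤u : 1 ≤ u
    u≤K : u ≤ K
    minimal : ∀ t → 1 ≤ t → t ≤ K → f u ≤ f t
    strictAfter : ∀ t → u < t → t ≤ K → f u < f t

lastMinimum-≮ : ∀ {f K u v} → IsLastMinimum f K u → IsLastMinimum f K v → ¬ u < v
lastMinimum-≮ {u = u} {v} U V u<v = ℕₚ.<⇒≱ (strictAfter U v u<v (u≤K V)) (minimal V u (1≤u U) (u≤K U))
  where open IsLastMinimum

lastMinimum-unique : ∀ {f K u v} → IsLastMinimum f K u → IsLastMinimum f K v → u ≡ v
lastMinimum-unique {u = u} {v} U V with ℕₚ.<-cmp u v
... | tri< u<v _ _ = ⊥-elim (lastMinimum-≮ U V u<v)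
... | tri≈ _ u≡v _ = u≡v
... | tri> _ _ v<u = ⊥-elim (lastMinimum-≮ V U v<u)

lastMinimum-suc : ∀ {f K u} → IsLastMinimum f K u → ∃ (IsLastMinimum f (suc K))
lastMinimum-suc {f} {K} {u} (lastMinimum 1≤u u≤K minimal strictAfter) with f (suc K) ≤? f u
... | yes fK+1≤fu = suc K , lastMinimum (s≤s z≤n) ℕₚ.≤-refl minimal′ nothingAfter
  where
  minimal′ : ∀ t → 1 ≤ t → t ≤ suc K → f (suc K) ≤ f t
  minimal′ t 1≤t t≤K+1 with ℕₚ.m≤n⇒m<n∨m≡n t≤K+1
  ... | inj₁ t<K+1 = ℕₚ.≤-trans fK+1≤fu (minimal t 1≤t (ℕₚ.≤-pred t<K+1))
  ... | inj₂ refl = ℕₚ.≤-refl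
  nothingAfter : ∀ t → suc K < t → t ≤ suc K → f (suc K) < f t
  nothingAfter t K+1<t t≤K+1 = ⊥-elim (ℕₚ.<-irrefl refl (ℕₚ.<-≤-trans K+1<t t≤K+1))
... | no fK+1≰fu = u , lastMinimum 1≤u (ℕₚ.m≤n⇒m≤1+n u≤K) minimal′ strictAfter′
  where
  minimal′ : ∀ t → 1 ≤ t → t ≤ suc K → f u ≤ f t
  minimal′ t 1≤t t≤K+1 with ℕₚ.m≤n⇒m<n∨m≡n t≤K+1
  ... | inj₁ t<K+1 = minimal t 1≤t (ℕₚ.≤-pred t<K+1)
  ... | inj₂ refl = ℕₚ.<⇒≤ (ℕₚ.≰⇒> fK+1≰fu)
  strictAfter′ : ∀ t → u < t → t ≤ suc K → f u < f t
  strictAfter′ t u<t t≤K+1 with ℕₚ.m≤n⇒m<n∨m≡n t≤K+1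
  ... | inj₁ t<K+1 = strictAfter t u<t (ℕₚ.≤-pred t<K+1)
  ... | inj₂ refl = ℕₚ.≰⇒> fK+1≰fu

lastMinimum-exists : ∀ f K → ∃ (IsLastMinimum f (suc K))
lastMinimum-exists f zero = 1 , lastMinimum ℕₚ.≤-refl ℕₚ.≤-refl minimal nothingAfter
  where
  minimal : ∀ t → 1 ≤ t → t ≤ 1 → f 1 ≤ f t
  minimal t 1≤t t≤1 = ℕₚ.≤-reflexive (cong f (ℕₚ.≤-antisym 1≤t t≤1))
  nothingAfter : ∀ t → 1 < t → t ≤ 1 → f 1 < f t
  nothingAfter t 1<t t≤1 = ⊥-elim (ℕₚ.<-irrefl refl (ℕₚ.<-≤-trans 1<t t≤1))
lastMinimum-exists f (suc K) = lastMinimum-suc (proj₂ (lastMinimum-exists f K))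

a+b≡c+d⇒d<a⇒b<c : ∀ {a b c d} → a ℕ.+ b ≡ c ℕ.+ d → d < a → b < c
a+b≡c+d⇒d<a⇒b<c {a} {b} {c} {d} a+b≡c+d d<a =
  ℕₚ.+-cancelʳ-< d b c (subst₂ _<_ (ℕₚ.+-comm d b) a+b≡c+d (ℕₚ.+-monoˡ-< b d<a))

downwardInduction : ∀ {p} (P : ℕ → Set p) N →
  (∀ s → N ≤ s → P s) → (∀ s → P (suc s) → P s) → ∀ s → P s
downwardInduction P N base step s = go N s (ℕₚ.m≤n+m N s)
  where
  go : ∀ k s → N ≤ s ℕ.+ k → P s
  go zero s N≤s = base s (subst (N ≤_) (ℕₚ.+-identityʳ s) N≤s)
  go (suc k) s N≤s+k = step s (go k (suc s) (subst (N ≤_) (ℕₚ.+-suc s k) N≤s+k))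


module ParkingFunctions where
  open import Data.Nat using (_+_)
  open import Data.Nat.Tactic.RingSolver using (solve-∀)
  open import Data.List.Relation.Unary.Linked as Linked using (Linked)
  open import Data.List.Relation.Unary.Linked.Properties using (Linked⇒AllPairs)
  open import Data.List.Relation.Unary.AllPairs using (_∷_)
  open import Data.List.Relation.Binary.Permutation.Propositional as ↭ using (_↭_; ↭-sym)
  open import Data.List.Relation.Binary.Permutation.Propositional.Properties using (↭-length)
  open import Data.List.Sort.InsertionSort.Base ℕₚ.≤-decTotalOrder using (sort)
  open import Data.List.Sort.InsertionSort.Properties ℕₚ.≤-decTotalOrder using (sort-↭; sort-↗)

  occurrences : (ℕ → Bool) → List ℕ → ℕ
  occurrences p l = count (map p l)

  occurrences-↭ : ∀ p {l l′} → l ↭ l′ → occurrences p l ≡ occurrences p l′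
  occurrences-↭ p ↭.refl = refl
  occurrences-↭ p (↭.prep a r) with p a
  ... | true = cong suc (occurrences-↭ p r)
  ... | false = occurrences-↭ p r
  occurrences-↭ p (↭.swap a b r) with p a | p b
  ... | true | true = cong (λ c → suc (suc c)) (occurrences-↭ p r)
  ... | true | false = cong suc (occurrences-↭ p r)
  ... | false | true = cong suc (occurrences-↭ p r)
  ... | false | false = occurrences-↭ p r
  occurrences-↭ p (↭.trans r r′) = trans (occurrences-↭ p r) (occurrences-↭ p r′)

  occurrences-map : ∀ p f l → occurrences p (map f l) ≡ occurrences (λ a → p (f a)) l
  occurrences-map p f l = cong count (sym (Listₚ.map-∘ l))

  occurrences≤length : ∀ p l → occurrences p l ≤ length l
  occurrences≤length p [] = z≤n
  occurrences≤length p (a ∷ l) with p a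
  ... | true = s≤s (occurrences≤length p l)
  ... | false = ℕₚ.m≤n⇒m≤1+n (occurrences≤length p l)

  bit : Bool → ℕ
  bit true = 1
  bit false = 0

  occurrences-cons : ∀ p a l → occurrences p (a ∷ l) ≡ bit (p a) + occurrences p l
  occurrences-cons p a l with p a
  ... | true = refl
  ... | false = refl

  occurrences-false : ∀ l → occurrences (λ _ → false) l ≡ 0
  occurrences-false [] = refl
  occurrences-false (_ ∷ l) = occurrences-false l

  occurrences-true : ∀ l → occurrences (λ _ → true) l ≡ length l
  occurrences-true [] = refl
  occurrences-true (_ ∷ l) = cong suc (occurrences-true l)

  occurrences-pointwise : ∀ (p q r s : ℕ → Bool) {P : ℕ → Set} l → All P l →
    (∀ a → P a → bit (p a) + bit (q a) ≡ bit (r a) + bit (s a)) →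
    occurrences p l + occurrences q l ≡ occurrences r l + occurrences s l
  occurrences-pointwise p q r s [] [] _ = refl
  occurrences-pointwise p q r s (a ∷ l) (Pa ∷ Pl) pointwise = begin
    occurrences p (a ∷ l) + occurrences q (a ∷ l)
      ≡⟨ cong₂ _+_ (occurrences-cons p a l) (occurrences-cons q a l) ⟩
    bit (p a) + occurrences p l + (bit (q a) + occurrences q l)
      ≡⟨ interchange (bit (p a)) (occurrences p l) (bit (q a)) (occurrences q l) ⟩
    (bit (p a) + bit (q a)) + (occurrences p l + occurrences q l)
      ≡⟨ cong₂ _+_ (pointwise a Pa) (occurrences-pointwise p q r s l Pl pointwise) ⟩
    (bit (r a) + bit (s a)) + (occurrences r l + occurrences s l)
      ≡⟨ interchange (bit (r a)) (bit (s a)) (occurrences r l) (occurrences s l) ⟩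
    bit (r a) + occurrences r l + (bit (s a) + occurrences s l)
      ≡⟨ cong₂ _+_ (occurrences-cons r a l) (occurrences-cons s a l) ⟨
    occurrences r (a ∷ l) + occurrences s (a ∷ l) ∎
    where
    open ≡-Reasoning
    interchange : ∀ w x y z → w + x + (y + z) ≡ (w + y) + (x + z)
    interchange = solve-∀

  atMost : ℕ → List ℕ → ℕ
  atMost k = occurrences (_≤ᵇ k)

  atMost-cons : ∀ k a s → a ≤ k → atMost k (a ∷ s) ≡ suc (atMost k s)
  atMost-cons k a s a≤k rewrite ≤ᵇ≡true a≤k = refl

  atMost≡0 : ∀ k s → All (k <_) s → atMost k s ≡ 0
  atMost≡0 k [] [] = refl
  atMost≡0 k (a ∷ s) (k<a ∷ k<s) rewrite ≤ᵇ≡false k<a = atMost≡0 k s k<s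

  All≤⇒atMost≡length : ∀ k l → All (_≤ k) l → atMost k l ≡ length l
  All≤⇒atMost≡length k [] [] = refl
  All≤⇒atMost≡length k (a ∷ l) (a≤k ∷ l≤k) rewrite ≤ᵇ≡true a≤k =
    cong suc (All≤⇒atMost≡length k l l≤k)

  length≤atMost⇒All≤ : ∀ k l → length l ≤ atMost k l → All (_≤ k) l
  length≤atMost⇒All≤ k [] _ = []
  length≤atMost⇒All≤ k (a ∷ l) h with a ≤ᵇ k in a≤ᵇk
  ... | true = ≤ᵇ≡true⇒≤ a≤ᵇk ∷ length≤atMost⇒All≤ k l (ℕₚ.≤-pred h)
  ... | false = ⊥-elim (ℕₚ.<-irrefl refl (ℕₚ.≤-trans h (occurrences≤length (_≤ᵇ k) l)))

  -- Equivalently, the t-th smallest entry of s (from t = 0) is at most j + t.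
  Parking : ℕ → List ℕ → Set
  Parking j s = ∀ t → t < length s → suc t ≤ atMost (j + t) s

  Parking-↭ : ∀ j {l l′} → l ↭ l′ → Parking j l → Parking j l′
  Parking-↭ j l↭l′ park t t<l′ =
    subst (suc t ≤_) (occurrences-↭ _ l↭l′) (park t (subst (t <_) (sym (↭-length l↭l′)) t<l′))

  boundedFrom⇒Parking : ∀ j s → boundedFrom j s ≡ true → Parking j s
  boundedFrom⇒Parking j (a ∷ s) h t t<l =
    subst (suc t ≤_) (sym (atMost-cons (j + t) a s (ℕₚ.≤-trans (≤ᵇ≡true⇒≤ a≤j) (ℕₚ.m≤m+n j t))))
      (s≤s (rest t t<l))
    where
    a≤j = proj₁ (∧≡true⁻ {a ≤ᵇ j} h)
    rest : ∀ t → t < suc (length s) → t ≤ atMost (j + t) s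
    rest zero _ = z≤n
    rest (suc t) (s≤s t<l) = subst (λ i → suc t ≤ atMost i s) (sym (ℕₚ.+-suc j t))
      (boundedFrom⇒Parking (suc j) s (proj₂ (∧≡true⁻ {a ≤ᵇ j} h)) t t<l)

  Parking⇒boundedFrom : ∀ j s → Linked _≤_ s → Parking j s → boundedFrom j s ≡ true
  Parking⇒boundedFrom j [] _ _ = refl
  Parking⇒boundedFrom j (a ∷ s) sorted park with a ≤ᵇ j in a≤ᵇj
  ... | true = Parking⇒boundedFrom (suc j) s (Linked.tail sorted) park′
    where
    a≤1+j+t : ∀ t → a ≤ suc (j + t)
    a≤1+j+t t = ℕₚ.≤-trans (≤ᵇ≡true⇒≤ a≤ᵇj) (ℕₚ.m≤n⇒m≤1+n (ℕₚ.m≤m+n j t))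
    park′ : Parking (suc j) s
    park′ t t<l = ℕₚ.≤-pred (subst (suc (suc t) ≤_)
      (trans (cong (λ i → atMost i (a ∷ s)) (ℕₚ.+-suc j t)) (atMost-cons (suc (j + t)) a s (a≤1+j+t t)))
      (park (suc t) (s≤s t<l)))
  ... | false with Linked⇒AllPairs ℕₚ.≤-trans sorted
  ...   | a≤s ∷ _ = ⊥-elim (ℕₚ.<-irrefl refl (subst (1 ≤_) none (park 0 (s≤s z≤n))))
    where
    j<a : j < a
    j<a = ℕₚ.≰⇒> (λ a≤j → subst T a≤ᵇj (ℕₚ.≤⇒≤ᵇ a≤j))
    none : atMost (j + 0) (a ∷ s) ≡ 0
    none rewrite ℕₚ.+-identityʳ j | a≤ᵇj = atMost≡0 j s (All.map (ℕₚ.<-≤-trans j<a) a≤s)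

  IsParkingFunction : List ℕ → Set
  IsParkingFunction π = All (1 ≤_) π × Parking 1 π

  isPF⇒IsParkingFunction : ∀ π → isPF π ≡ true → IsParkingFunction π
  isPF⇒IsParkingFunction π h with positive , bounded ← ∧≡true⁻ {allB (1 ≤ᵇ_) π} h =
    All.map ≤ᵇ≡true⇒≤ (allB≡true⇒All (1 ≤ᵇ_) π positive) ,
    Parking-↭ 1 (sort-↭ π) (boundedFrom⇒Parking 1 (sort π) bounded)

  IsParkingFunction⇒isPF : ∀ π → IsParkingFunction π → isPF π ≡ true
  IsParkingFunction⇒isPF π (positive , park) =
    ∧≡true⁺ (All⇒allB≡true (1 ≤ᵇ_) π (All.map ≤ᵇ≡true positive))
            (Parking⇒boundedFrom 1 (sort π) (sort-↗ π) (Parking-↭ 1 (↭-sym (sort-↭ π)) park))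

  data OneAt : List ℕ → ℕ → Set where
    here  : ∀ {π} → OneAt (1 ∷ π) 0
    there : ∀ {a π k} → OneAt π k → OneAt (a ∷ π) (suc k)

  oneAt-exists : ∀ π → All (1 ≤_) π → 1 ≤ atMost 1 π → ∃ (OneAt π)
  oneAt-exists (zero ∷ π) (() ∷ _) _
  oneAt-exists (suc zero ∷ π) _ _ = 0 , here
  oneAt-exists (suc (suc a) ∷ π) (_ ∷ positive) h with k , one ← oneAt-exists π positive h =
    suc k , there one

  atMost-removeAt : ∀ {π k} t → 1 ≤ t → OneAt π k → suc (atMost t (removeAt π k)) ≡ atMost t π
  atMost-removeAt t 1≤t (here {π}) = sym (atMost-cons t 1 π 1≤t)
  atMost-removeAt t 1≤t (there {a} one) with a ≤ᵇ t
  ... | true = cong suc (atMost-removeAt t 1≤t one)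
  ... | false = atMost-removeAt t 1≤t one

  length-removeAt : ∀ {π k} → OneAt π k → suc (length (removeAt π k)) ≡ length π
  length-removeAt here = refl
  length-removeAt (there one) = cong suc (length-removeAt one)

  All-removeAt : ∀ {P : ℕ → Set} {π k} → OneAt π k → All P π → All P (removeAt π k)
  All-removeAt here (_ ∷ ps) = ps
  All-removeAt (there one) (p ∷ ps) = p ∷ All-removeAt one ps

  allB-onesPos⁻ : ∀ Q i π → allB Q (onesPos i π) ≡ true → ∀ k → OneAt π k → Q (i + k) ≡ true
  allB-onesPos⁻ Q i (a ∷ π) h zero here =
    subst (λ j → Q j ≡ true) (sym (ℕₚ.+-identityʳ i)) (proj₁ (∧≡true⁻ {Q i} h))
  allB-onesPos⁻ Q i (a ∷ π) h (suc k) (there one) with a ≡ᵇ 1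
  ... | true = subst (λ j → Q j ≡ true) (sym (ℕₚ.+-suc i k))
    (allB-onesPos⁻ Q (suc i) π (proj₂ (∧≡true⁻ {Q i} h)) k one)
  ... | false = subst (λ j → Q j ≡ true) (sym (ℕₚ.+-suc i k)) (allB-onesPos⁻ Q (suc i) π h k one)

  onesAfter : ∀ (Q : ℕ → Bool) i {a π} → (∀ k → OneAt (a ∷ π) k → Q (i + k) ≡ true) →
    ∀ k → OneAt π k → Q (suc i + k) ≡ true
  onesAfter Q i h k one = subst (λ j → Q j ≡ true) (ℕₚ.+-suc i k) (h (suc k) (there one))

  allB-onesPos⁺ : ∀ Q i π → (∀ k → OneAt π k → Q (i + k) ≡ true) → allB Q (onesPos i π) ≡ true
  allB-onesPos⁺ Q i [] _ = refl
  allB-onesPos⁺ Q i (a ∷ π) h with a ≡ᵇ 1 in a≡ᵇ1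
  ... | true = ∧≡true⁺ (subst (λ j → Q j ≡ true) (ℕₚ.+-identityʳ i) (h 0 oneHere))
    (allB-onesPos⁺ Q (suc i) π (onesAfter Q i h))
    where
    oneHere = subst (λ b → OneAt (b ∷ π) 0) (sym (≡ᵇ≡true⇒≡ a≡ᵇ1)) here
  ... | false = allB-onesPos⁺ Q (suc i) π (onesAfter Q i h)

  PrimeParking : ℕ → List ℕ → Set
  PrimeParking M π = All (1 ≤_) π × All (_≤ M) π × (∀ k → 1 ≤ k → k < M → suc k ≤ atMost k π)

  isPPF⇒PrimeParking : ∀ M π → 1 ≤ M → length π ≡ suc M → isPPF π ≡ true → PrimeParking M π
  isPPF⇒PrimeParking M π 1≤M len h
    with isPF-π , ones ← ∧≡true⁻ {isPF π} h
    with positive , park ← isPF⇒IsParkingFunction π isPF-π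
    with k , one ← oneAt-exists π positive (park 0 (subst (0 <_) (sym len) (s≤s z≤n)))
    with _ , park′ ← isPF⇒IsParkingFunction (removeAt π k) (allB-onesPos⁻ _ 0 π ones k one) =
    positive , bounded , λ k 1≤k k<M → excess k 1≤k (ℕₚ.<⇒≤ k<M)
    where
    excess : ∀ k → 1 ≤ k → k ≤ M → suc k ≤ atMost k π
    excess (suc t) _ t<M = subst (suc (suc t) ≤_) (atMost-removeAt (suc t) (s≤s z≤n) one)
      (s≤s (park′ t (subst (t <_) (ℕₚ.suc-injective (sym (trans (length-removeAt one) len))) t<M)))
    bounded : All (_≤ M) π
    bounded = length≤atMost⇒All≤ M π (subst (_≤ atMost M π) (sym len) (excess M 1≤M ℕₚ.≤-refl))

  PrimeParking⇒isPPF : ∀ M π → length π ≡ suc M → PrimeParking M π → isPPF π ≡ true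
  PrimeParking⇒isPPF M π len (positive , bounded , prime) =
    ∧≡true⁺ (IsParkingFunction⇒isPF π (positive , park))
      (allB-onesPos⁺ _ 0 π (λ k one →
        IsParkingFunction⇒isPF (removeAt π k) (All-removeAt one positive , park-removed one)))
    where
    full : ∀ k → M ≤ k → atMost k π ≡ suc M
    full k M≤k = trans (All≤⇒atMost≡length k π (All.map (λ a≤M → ℕₚ.≤-trans a≤M M≤k) bounded)) len
    excess : ∀ t → t < M → suc (suc t) ≤ atMost (suc t) π
    excess t t<M with suc t <? M
    ... | yes 1+t<M = prime (suc t) (s≤s z≤n) 1+t<M
    ... | no 1+t≮M = subst (suc (suc t) ≤_) (sym (full (suc t) (ℕₚ.≮⇒≥ 1+t≮M))) (s≤s t<M)
    park : Parking 1 π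
    park t t<1+M with t <? M
    ... | yes t<M = ℕₚ.≤-trans (ℕₚ.n≤1+n (suc t)) (excess t t<M)
    ... | no t≮M = subst (suc t ≤_) (sym (full (suc t) (ℕₚ.m≤n⇒m≤1+n (ℕₚ.≮⇒≥ t≮M)))) (subst (t <_) len t<1+M)
    park-removed : ∀ {k} → OneAt π k → Parking 1 (removeAt π k)
    park-removed one t t<M = ℕₚ.≤-pred (subst (suc (suc t) ≤_) (sym (atMost-removeAt (suc t) (s≤s z≤n) one))
      (excess t (subst (t <_) (ℕₚ.suc-injective (trans (length-removeAt one) len)) t<M)))

module CycleLemma (M-1 : ℕ) where
  open import Data.Nat using (_+_)
  open import Data.Nat.Tactic.RingSolver using (solve-∀)
  open ParkingFunctions
  open ≡-Reasoning

  M : ℕ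
  M = suc M-1

  rot : ℕ → ℕ → ℕ
  rot c a = (a + c) % M

  steps : ℕ → List ℕ → List ℕ
  steps c [] = []
  steps c (e ∷ d) = rot e c ∷ steps (rot e c) d

  -- map suc (walk c d) is the word with first entry c + 1 whose forward differences are d modulo M.
  walk : ℕ → List ℕ → List ℕ
  walk c d = c ∷ steps c d

  [m%M+n]%M≡[m+n]%M : ∀ m n → (m % M + n) % M ≡ (m + n) % M
  [m%M+n]%M≡[m+n]%M m n = begin
    (m % M + n) % M         ≡⟨ %-distribˡ-+ (m % M) n M ⟩
    (m % M % M + n % M) % M ≡⟨ cong (λ r → (r + n % M) % M) (m%n%n≡m%n m M) ⟩
    (m % M + n % M) % M     ≡⟨ %-distribˡ-+ m n M ⟨
    (m + n) % M             ∎

  rot-comm : ∀ c e a → rot c (rot e a) ≡ rot e (rot c a)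
  rot-comm c e a = begin
    ((a + e) % M + c) % M ≡⟨ [m%M+n]%M≡[m+n]%M (a + e) c ⟩
    (a + e + c) % M       ≡⟨ cong (_% M) (swap a e c) ⟩
    (a + c + e) % M       ≡⟨ [m%M+n]%M≡[m+n]%M (a + c) e ⟨
    ((a + c) % M + e) % M ∎
    where
    swap : ∀ a e c → a + e + c ≡ a + c + e
    swap = solve-∀

  map-rot-steps : ∀ c a d → map (rot c) (steps a d) ≡ steps (rot c a) d
  map-rot-steps c a [] = refl
  map-rot-steps c a (e ∷ d) =
    cong₂ _∷_ (rot-comm c e a) (trans (map-rot-steps c (rot e a) d) (cong (λ b → steps b d) (rot-comm c e a)))

  walk≡map-rot-walk : ∀ c d → c < M → walk c d ≡ map (rot c) (walk 0 d)
  walk≡map-rot-walk c d c<M = sym (cong₂ _∷_ c%M≡c (trans (map-rot-steps c 0 d) (cong (λ b → steps b d) c%M≡c)))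
    where
    c%M≡c : c % M ≡ c
    c%M≡c = m<n⇒m%n≡m c<M

  rot<M : ∀ c a → rot c a < M
  rot<M c a = m%n<n (a + c) M

  steps<M : ∀ c d → All (_< M) (steps c d)
  steps<M c [] = []
  steps<M c (e ∷ d) = rot<M e c ∷ steps<M (rot e c) d

  length-steps : ∀ c d → length (steps c d) ≡ length d
  length-steps c [] = refl
  length-steps c (e ∷ d) = cong suc (length-steps (rot e c) d)

  rot-noWrap : ∀ c a → a + c < M → rot c a ≡ a + c
  rot-noWrap c a = m<n⇒m%n≡m

  rot-wrap : ∀ c a → c ≤ M → M ∸ c ≤ a → a < M → rot c a ≡ a ∸ (M ∸ c)
  rot-wrap c a c≤M M∸c≤a a<M = begin
    (a + c) % M                       ≡⟨ cong (λ b → (b + c) % M) (ℕₚ.m+[n∸m]≡n M∸c≤a) ⟨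
    ((M ∸ c) + (a ∸ (M ∸ c)) + c) % M ≡⟨ cong (_% M) (swap (M ∸ c) (a ∸ (M ∸ c)) c) ⟩
    ((a ∸ (M ∸ c)) + ((M ∸ c) + c)) % M ≡⟨ cong (λ b → ((a ∸ (M ∸ c)) + b) % M) (ℕₚ.m∸n+n≡m c≤M) ⟩
    ((a ∸ (M ∸ c)) + M) % M           ≡⟨ [m+n]%n≡m%n (a ∸ (M ∸ c)) M ⟩
    (a ∸ (M ∸ c)) % M                 ≡⟨ m<n⇒m%n≡m (ℕₚ.≤-<-trans (ℕₚ.m∸n≤m a (M ∸ c)) a<M) ⟩
    a ∸ (M ∸ c)                       ∎
    where
    swap : ∀ u x c → u + x + c ≡ x + (u + c)
    swap = solve-∀

  wrapped<c : ∀ c a → c ≤ M → M ∸ c ≤ a → a < M → a ∸ (M ∸ c) < c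
  wrapped<c c a c≤M M∸c≤a a<M = ℕₚ.+-cancelˡ-< (M ∸ c) (a ∸ (M ∸ c)) c
    (subst₂ _<_ (sym (ℕₚ.m+[n∸m]≡n M∸c≤a)) (sym (ℕₚ.m∸n+n≡m c≤M)) a<M)

  u+x<ᵇu+y≡x<ᵇy : ∀ u x y → (u + x <ᵇ u + y) ≡ (x <ᵇ y)
  u+x<ᵇu+y≡x<ᵇy zero x y = refl
  u+x<ᵇu+y≡x<ᵇy (suc u) x y = u+x<ᵇu+y≡x<ᵇy u x y

  a+c<ᵇk≡a<ᵇk∸c : ∀ a c k → c ≤ k → (a + c <ᵇ k) ≡ (a <ᵇ k ∸ c)
  a+c<ᵇk≡a<ᵇk∸c a zero k _ rewrite ℕₚ.+-identityʳ a = refl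
  a+c<ᵇk≡a<ᵇk∸c a (suc c) (suc k) (s≤s c≤k) rewrite ℕₚ.+-suc a c = a+c<ᵇk≡a<ᵇk∸c a c k c≤k

  rot<-short : ∀ c k a → c < M → k ≤ c → a < M →
    bit (rot c a <ᵇ k) + bit (a <ᵇ M ∸ c) ≡ bit (a <ᵇ M ∸ c + k) + bit false
  rot<-short c k a c<M k≤c a<M with a <? M ∸ c
  ... | yes a<M∸c
    rewrite rot-noWrap c a (subst (a + c <_) (ℕₚ.m∸n+n≡m (ℕₚ.<⇒≤ c<M)) (ℕₚ.+-monoˡ-< c a<M∸c))
          | <ᵇ≡false {a + c} {k} (ℕₚ.≤-trans k≤c (ℕₚ.m≤n+m c a))
          | <ᵇ≡true a<M∸c | <ᵇ≡true (ℕₚ.≤-trans a<M∸c (ℕₚ.m≤m+n (M ∸ c) k)) = refl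
  ... | no a≮M∸c
    rewrite rot-wrap c a (ℕₚ.<⇒≤ c<M) (ℕₚ.≮⇒≥ a≮M∸c) a<M | <ᵇ≡false (ℕₚ.≮⇒≥ a≮M∸c) =
    cong (λ b → bit b + 0) (begin
      a ∸ (M ∸ c) <ᵇ k                     ≡⟨ u+x<ᵇu+y≡x<ᵇy (M ∸ c) (a ∸ (M ∸ c)) k ⟨
      (M ∸ c) + (a ∸ (M ∸ c)) <ᵇ M ∸ c + k ≡⟨ cong (_<ᵇ M ∸ c + k) (ℕₚ.m+[n∸m]≡n (ℕₚ.≮⇒≥ a≮M∸c)) ⟩
      a <ᵇ M ∸ c + k                       ∎)

  rot<-long : ∀ c k a → c < k → k ≤ M → a < M →
    bit (rot c a <ᵇ k) + bit (a <ᵇ M ∸ c) ≡ bit (a <ᵇ k ∸ c) + bit true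
  rot<-long c k a c<k k≤M a<M with c≤M ← ℕₚ.≤-trans (ℕₚ.<⇒≤ c<k) k≤M | a <? M ∸ c
  ... | yes a<M∸c
    rewrite rot-noWrap c a (subst (a + c <_) (ℕₚ.m∸n+n≡m c≤M) (ℕₚ.+-monoˡ-< c a<M∸c))
          | a+c<ᵇk≡a<ᵇk∸c a c k (ℕₚ.<⇒≤ c<k) | <ᵇ≡true a<M∸c = refl
  ... | no a≮M∸c
    rewrite rot-wrap c a c≤M (ℕₚ.≮⇒≥ a≮M∸c) a<M | <ᵇ≡false (ℕₚ.≮⇒≥ a≮M∸c)
          | <ᵇ≡true {a ∸ (M ∸ c)} {k} (ℕₚ.<-trans (wrapped<c c a c≤M (ℕₚ.≮⇒≥ a≮M∸c) a<M) c<k)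
          | <ᵇ≡false {a} {k ∸ c} (ℕₚ.≤-trans (ℕₚ.∸-monoˡ-≤ c k≤M) (ℕₚ.≮⇒≥ a≮M∸c)) = refl

  rotatedBelow : ℕ → List ℕ → ℕ → ℕ
  rotatedBelow c w k = occurrences (λ a → rot c a <ᵇ k) w

  -- rotatedBelow c w k is a difference of heights (height-short, height-long), which turns Good c w
  -- into: M ∸ c is the last minimum of height w on [1, M].
  height : List ℕ → ℕ → ℕ
  height w t = occurrences (_<ᵇ t) w + (M ∸ t)

  height-short : ∀ c k w → c < M → k ≤ c → All (_< M) w →
    rotatedBelow c w k + height w (M ∸ c) ≡ height w (M ∸ c + k) + k
  height-short c k w c<M k≤c w<M = begin
    rotatedBelow c w k + (below (M ∸ c) + (M ∸ (M ∸ c))) ≡⟨ ℕₚ.+-assoc (rotatedBelow c w k) _ _ ⟨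
    rotatedBelow c w k + below (M ∸ c) + (M ∸ (M ∸ c))   ≡⟨ cong₂ _+_ counts (ℕₚ.m∸[m∸n]≡n c≤M) ⟩
    below (M ∸ c + k) + c                                 ≡⟨ cong (below (M ∸ c + k) +_) gap ⟨
    below (M ∸ c + k) + ((M ∸ (M ∸ c + k)) + k)           ≡⟨ ℕₚ.+-assoc (below (M ∸ c + k)) _ k ⟨
    height w (M ∸ c + k) + k                              ∎
    where
    below : ℕ → ℕ
    below t = occurrences (_<ᵇ t) w
    c≤M = ℕₚ.<⇒≤ c<M
    counts : rotatedBelow c w k + below (M ∸ c) ≡ below (M ∸ c + k)
    counts = trans (occurrences-pointwise _ _ _ (λ _ → false) w w<M (λ a → rot<-short c k a c<M k≤c))
                   (trans (cong (below (M ∸ c + k) +_) (occurrences-false w)) (ℕₚ.+-identityʳ _))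
    gap : (M ∸ (M ∸ c + k)) + k ≡ c
    gap = begin
      (M ∸ (M ∸ c + k)) + k ≡⟨ cong (_+ k) (ℕₚ.∸-+-assoc M (M ∸ c) k) ⟨
      (M ∸ (M ∸ c) ∸ k) + k ≡⟨ cong (λ b → b ∸ k + k) (ℕₚ.m∸[m∸n]≡n c≤M) ⟩
      c ∸ k + k             ≡⟨ ℕₚ.m∸n+n≡m k≤c ⟩
      c                     ∎

  height-long : ∀ c k w → c < k → k ≤ M → All (_< M) w → length w ≡ suc M →
    rotatedBelow c w k + height w (M ∸ c) ≡ suc (height w (k ∸ c) + k)
  height-long c k w c<k k≤M w<M len = begin
    rotatedBelow c w k + (below (M ∸ c) + (M ∸ (M ∸ c))) ≡⟨ ℕₚ.+-assoc (rotatedBelow c w k) _ _ ⟨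
    rotatedBelow c w k + below (M ∸ c) + (M ∸ (M ∸ c))   ≡⟨ cong₂ _+_ counts (ℕₚ.m∸[m∸n]≡n c≤M) ⟩
    below (k ∸ c) + suc M + c                             ≡⟨ regroup (below (k ∸ c)) M c ⟩
    suc (below (k ∸ c) + (M + c))                         ≡⟨ cong (λ b → suc (below (k ∸ c) + b)) gap ⟨
    suc (below (k ∸ c) + ((M ∸ (k ∸ c)) + k))             ≡⟨ cong suc (ℕₚ.+-assoc (below (k ∸ c)) _ k) ⟨
    suc (height w (k ∸ c) + k)                            ∎
    where
    below : ℕ → ℕ
    below t = occurrences (_<ᵇ t) w
    c≤M = ℕₚ.≤-trans (ℕₚ.<⇒≤ c<k) k≤M
    counts : rotatedBelow c w k + below (M ∸ c) ≡ below (k ∸ c) + suc M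
    counts = trans (occurrences-pointwise _ _ _ (λ _ → true) w w<M (λ a → rot<-long c k a c<k k≤M))
                   (cong (below (k ∸ c) +_) (trans (occurrences-true w) len))
    regroup : ∀ b m c → b + suc m + c ≡ suc (b + (m + c))
    regroup = solve-∀
    gap : (M ∸ (k ∸ c)) + k ≡ M + c
    gap = begin
      M ∸ (k ∸ c) + k           ≡⟨ cong (M ∸ (k ∸ c) +_) (ℕₚ.m∸n+n≡m (ℕₚ.<⇒≤ c<k)) ⟨
      M ∸ (k ∸ c) + (k ∸ c + c) ≡⟨ ℕₚ.+-assoc (M ∸ (k ∸ c)) (k ∸ c) c ⟨
      M ∸ (k ∸ c) + (k ∸ c) + c ≡⟨ cong (_+ c) (ℕₚ.m∸n+n≡m (ℕₚ.≤-trans (ℕₚ.m∸n≤m k c) k≤M)) ⟩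
      M + c                     ∎

  Good : ℕ → List ℕ → Set
  Good c w = ∀ k → 1 ≤ k → k < M → suc k ≤ rotatedBelow c w k

  Good⇒lastMinimum : ∀ c w → c < M → All (_< M) w → length w ≡ suc M →
    Good c w → IsLastMinimum (height w) M (M ∸ c)
  Good⇒lastMinimum c w c<M w<M len good = lastMinimum (ℕₚ.m<n⇒0<n∸m c<M) (ℕₚ.m∸n≤m M c) minimal strictAfter
    where
    u = M ∸ c
    strictAfter : ∀ t → u < t → t ≤ M → height w u < height w t
    strictAfter t u<t t≤M = subst (λ s → height w u < height w s) (ℕₚ.m+[n∸m]≡n (ℕₚ.<⇒≤ u<t))
      (a+b≡c+d⇒d<a⇒b<c (height-short c (t ∸ u) w c<M t∸u≤c w<M)
                         (good (t ∸ u) (ℕₚ.m<n⇒0<n∸m u<t) (ℕₚ.≤-<-trans t∸u≤c c<M)))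
      where
      t∸u≤c : t ∸ u ≤ c
      t∸u≤c = subst (t ∸ u ≤_) (ℕₚ.m∸[m∸n]≡n (ℕₚ.<⇒≤ c<M)) (ℕₚ.∸-monoˡ-≤ u t≤M)
    minimal : ∀ t → 1 ≤ t → t ≤ M → height w u ≤ height w t
    minimal t 1≤t t≤M with ℕₚ.<-cmp t u
    ... | tri< t<u _ _ = subst (λ s → height w u ≤ height w s) (ℕₚ.m+n∸n≡m t c)
      (ℕₚ.≤-pred (a+b≡c+d⇒d<a⇒b<c (height-long c (t + c) w (ℕₚ.+-monoˡ-< c 1≤t) t+c≤M w<M len)
                                   (good (t + c) (ℕₚ.≤-trans 1≤t (ℕₚ.m≤m+n t c)) t+c<M)))
      where
      t+c<M : t + c < M
      t+c<M = subst (t + c <_) (ℕₚ.m∸n+n≡m (ℕₚ.<⇒≤ c<M)) (ℕₚ.+-monoˡ-< c t<u)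
      t+c≤M = ℕₚ.<⇒≤ t+c<M
    ... | tri≈ _ refl _ = ℕₚ.≤-refl
    ... | tri> _ _ u<t = ℕₚ.<⇒≤ (strictAfter t u<t t≤M)

  lastMinimum⇒Good : ∀ c w → c < M → All (_< M) w → length w ≡ suc M →
    IsLastMinimum (height w) M (M ∸ c) → Good c w
  lastMinimum⇒Good c w c<M w<M len (lastMinimum _ _ minimal strictAfter) k 1≤k k<M with k ≤? c
  ... | yes k≤c = a+b≡c+d⇒d<a⇒b<c (sym (height-short c k w c<M k≤c w<M))
    (strictAfter (M ∸ c + k) (ℕₚ.m<m+n (M ∸ c) 1≤k)
      (subst (M ∸ c + k ≤_) (ℕₚ.m∸n+n≡m (ℕₚ.<⇒≤ c<M)) (ℕₚ.+-monoʳ-≤ (M ∸ c) k≤c)))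
  ... | no k≰c = a+b≡c+d⇒d<a⇒b<c (sym (height-long c k w c<k (ℕₚ.<⇒≤ k<M) w<M len))
    (s≤s (minimal (k ∸ c) (ℕₚ.m<n⇒0<n∸m c<k) (ℕₚ.≤-trans (ℕₚ.m∸n≤m k c) (ℕₚ.<⇒≤ k<M))))
    where
    c<k = ℕₚ.≰⇒> k≰c

  Good-unique : ∀ c₁ c₂ w → c₁ < M → c₂ < M → All (_< M) w → length w ≡ suc M →
    Good c₁ w → Good c₂ w → c₁ ≡ c₂
  Good-unique c₁ c₂ w c₁<M c₂<M w<M len good₁ good₂ =
    ℕₚ.∸-cancelˡ-≡ (ℕₚ.<⇒≤ c₁<M) (ℕₚ.<⇒≤ c₂<M)
      (lastMinimum-unique (Good⇒lastMinimum c₁ w c₁<M w<M len good₁)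
                          (Good⇒lastMinimum c₂ w c₂<M w<M len good₂))

  Good-exists : ∀ w → All (_< M) w → length w ≡ suc M → ∃ λ c → c < M × Good c w
  Good-exists w w<M len with u , last ← lastMinimum-exists (height w) M-1 =
    M ∸ u , c<M , lastMinimum⇒Good (M ∸ u) w c<M w<M len
                    (subst (IsLastMinimum (height w) M) (sym M∸[M∸u]≡u) last)
    where
    open IsLastMinimum last
    c<M : M ∸ u < M
    c<M = ℕₚ.∸-monoʳ-< 1≤u u≤K
    M∸[M∸u]≡u : M ∸ (M ∸ u) ≡ u
    M∸[M∸u]≡u = ℕₚ.m∸[m∸n]≡n u≤K

  atMost-rotation : ∀ c w k → atMost k (map suc (map (rot c) w)) ≡ rotatedBelow c w k
  atMost-rotation c w k = trans (occurrences-map (_≤ᵇ k) suc (map (rot c) w)) (occurrences-map (_<ᵇ k) (rot c) w)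

  length-rotation : ∀ c w → length w ≡ suc M → length (map suc (map (rot c) w)) ≡ suc M
  length-rotation c w len = trans (Listₚ.length-map suc (map (rot c) w)) (trans (Listₚ.length-map (rot c) w) len)

  isPPF-rotation⇒Good : ∀ c w → length w ≡ suc M → isPPF (map suc (map (rot c) w)) ≡ true → Good c w
  isPPF-rotation⇒Good c w len ppf k 1≤k k<M
    with _ , _ , prime ← isPPF⇒PrimeParking M (map suc (map (rot c) w)) (s≤s z≤n) (length-rotation c w len) ppf =
    subst (suc k ≤_) (atMost-rotation c w k) (prime k 1≤k k<M)

  Good⇒isPPF-rotation : ∀ c w → length w ≡ suc M → Good c w → isPPF (map suc (map (rot c) w)) ≡ true
  Good⇒isPPF-rotation c w len good = PrimeParking⇒isPPF M (map suc (map (rot c) w)) (length-rotation c w len)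
    ( map⁺ (map⁺ (All.universal (λ _ → s≤s z≤n) w))
    , map⁺ (map⁺ (All.universal (rot<M c) w))
    , λ k 1≤k k<M → subst (suc k ≤_) (sym (atMost-rotation c w k)) (good k 1≤k k<M))

  cycleLemma : ∀ d → length d ≡ M →
    ∃ λ c₀ → c₀ < M × isPPF (map suc (walk c₀ d)) ≡ true ×
             (∀ c → c < M → isPPF (map suc (walk c d)) ≡ true → c ≡ c₀)
  cycleLemma d len = choose (Good-exists w w<M len′)
    where
    w = walk 0 d
    w<M : All (_< M) w
    w<M = s≤s z≤n ∷ steps<M 0 d
    len′ : length w ≡ suc M
    len′ = cong suc (trans (length-steps 0 d) len)
    isPPF-of : List ℕ → Set
    isPPF-of l = isPPF (map suc l) ≡ true
    choose : (∃ λ c → c < M × Good c w) →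
      ∃ λ c₀ → c₀ < M × isPPF-of (walk c₀ d) × (∀ c → c < M → isPPF-of (walk c d) → c ≡ c₀)
    choose (c₀ , c₀<M , good₀) =
      c₀ , c₀<M , subst isPPF-of (sym (walk≡map-rot-walk c₀ d c₀<M)) (Good⇒isPPF-rotation c₀ w len′ good₀) ,
      λ c c<M ppf → Good-unique c c₀ w c<M c₀<M w<M len′
        (isPPF-rotation⇒Good c w len′ (subst isPPF-of (walk≡map-rot-walk c d c<M) ppf)) good₀

open import Data.Integer using (+_; _+_; _*_; _-_; _^_; ∣_∣)
open import Data.Integer.Tactic.RingSolver using (solve-∀)

∑ : {A : Set} → List A → (A → ℤ) → ℤ
∑ L f = sumℤ (map f L)

syntax ∑ L (λ a → e) = ∑[ a ← L ] e

𝟙 : Bool → ℤ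
𝟙 true = + 1
𝟙 false = + 0

∑-++ : ∀ {A : Set} (L K : List A) f → ∑ (L ++ K) f ≡ ∑ L f + ∑ K f
∑-++ [] K f = sym (ℤₚ.+-identityˡ _)
∑-++ (a ∷ L) K f = trans (cong (_+_ (f a)) (∑-++ L K f)) (sym (ℤₚ.+-assoc (f a) _ _))

∑-cong : ∀ {A : Set} (L : List A) {f g} → (∀ a → f a ≡ g a) → ∑ L f ≡ ∑ L g
∑-cong [] _ = refl
∑-cong (a ∷ L) f≗g = cong₂ _+_ (f≗g a) (∑-cong L f≗g)

∑-zero : ∀ {A : Set} (L : List A) → ∑[ _ ← L ] (+ 0) ≡ + 0
∑-zero [] = refl
∑-zero (a ∷ L) = trans (ℤₚ.+-identityˡ _) (∑-zero L)

∑-+ : ∀ {A : Set} (L : List A) f g → ∑[ a ← L ] (f a + g a) ≡ ∑ L f + ∑ L g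
∑-+ [] f g = refl
∑-+ (a ∷ L) f g = trans (cong (_+_ (f a + g a)) (∑-+ L f g)) (interchange (f a) (g a) (∑ L f) (∑ L g))
  where
  interchange : ∀ w x y z → w + x + (y + z) ≡ w + y + (x + z)
  interchange = solve-∀

∑-*ˡ : ∀ {A : Set} (L : List A) c f → c * ∑ L f ≡ ∑[ a ← L ] (c * f a)
∑-*ˡ [] c f = ℤₚ.*-zeroʳ c
∑-*ˡ (a ∷ L) c f = trans (ℤₚ.*-distribˡ-+ c (f a) _) (cong (_+_ (c * f a)) (∑-*ˡ L c f))

∑-*ʳ : ∀ {A : Set} (L : List A) c f → ∑ L f * c ≡ ∑[ a ← L ] (f a * c)
∑-*ʳ L c f = trans (ℤₚ.*-comm _ c) (trans (∑-*ˡ L c f) (∑-cong L (λ a → ℤₚ.*-comm c (f a))))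

∑-filter : ∀ {A : Set} (p : A → Bool) (L : List A) f →
  ∑ (filter (λ a → T? (p a)) L) f ≡ ∑[ a ← L ] (𝟙 (p a) * f a)
∑-filter p [] f = refl
∑-filter p (a ∷ L) f with p a
... | true = cong₂ _+_ (sym (ℤₚ.*-identityˡ (f a))) (∑-filter p L f)
... | false = sym (trans (cong (_+ ∑[ a ← L ] (𝟙 (p a) * f a)) (ℤₚ.*-zeroˡ (f a)))
                         (trans (ℤₚ.+-identityˡ _) (sym (∑-filter p L f))))

∑-map : ∀ {A B : Set} (g : A → B) L (f : B → ℤ) → ∑ (map g L) f ≡ ∑[ a ← L ] f (g a)
∑-map g [] f = refl
∑-map g (a ∷ L) f = cong (_+_ (f (g a))) (∑-map g L f)

∑-concatMap : ∀ {A B : Set} (g : A → List B) L (f : B → ℤ) →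
  ∑ (concatMap g L) f ≡ ∑[ a ← L ] ∑ (g a) f
∑-concatMap g [] f = refl
∑-concatMap g (a ∷ L) f =
  trans (∑-++ (g a) (concatMap g L) f) (cong (_+_ (∑ (g a) f)) (∑-concatMap g L f))

∑-comm : ∀ {A B : Set} (L : List A) (K : List B) (f : A → B → ℤ) →
  ∑[ a ← L ] ∑[ b ← K ] f a b ≡ ∑[ b ← K ] ∑[ a ← L ] f a b
∑-comm [] K f = sym (∑-zero K)
∑-comm (a ∷ L) K f =
  trans (cong (_+_ (∑ K (f a))) (∑-comm L K f)) (sym (∑-+ K (f a) (λ b → ∑[ a ← L ] f a b)))

∑-*-∑ : ∀ {A B : Set} (L : List A) (K : List B) (f : A → ℤ) (g : B → ℤ) →
  ∑ L f * ∑ K g ≡ ∑[ a ← L ] ∑[ b ← K ] (f a * g b)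
∑-*-∑ L K f g = trans (∑-*ʳ L (∑ K g) f) (∑-cong L (λ a → ∑-*ˡ K (f a) g))

∑-applyUpTo : ∀ (g : ℕ → ℕ) n f → ∑ (applyUpTo g n) f ≡ ∑[ i ← upTo n ] f (g i)
∑-applyUpTo g zero f = refl
∑-applyUpTo g (suc n) f = cong (_+_ (f (g 0)))
  (trans (∑-applyUpTo (λ i → g (suc i)) n f) (sym (∑-applyUpTo suc n (λ i → f (g i)))))

∑-upTo-suc : ∀ n f → ∑ (upTo (suc n)) f ≡ f 0 + ∑[ i ← upTo n ] f (suc i)
∑-upTo-suc n f = cong (_+_ (f 0)) (∑-applyUpTo suc n f)

∑-upTo-sucʳ : ∀ n f → ∑ (upTo (suc n)) f ≡ ∑ (upTo n) f + f n
∑-upTo-sucʳ n f = begin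
  ∑ (upTo (suc n)) f          ≡⟨ cong (λ L → ∑ L f) (Listₚ.upTo-∷ʳ n) ⟨
  ∑ (upTo n ++ n ∷ []) f      ≡⟨ ∑-++ (upTo n) (n ∷ []) f ⟩
  ∑ (upTo n) f + (f n + + 0)  ≡⟨ cong (_+_ (∑ (upTo n) f)) (ℤₚ.+-identityʳ (f n)) ⟩
  ∑ (upTo n) f + f n          ∎
  where open ≡-Reasoning

∑-upTo-cong : ∀ n {f g} → (∀ i → i < n → f i ≡ g i) → ∑ (upTo n) f ≡ ∑ (upTo n) g
∑-upTo-cong zero _ = refl
∑-upTo-cong (suc n) {f} {g} f≗g = begin
  ∑ (upTo (suc n)) f  ≡⟨ ∑-upTo-sucʳ n f ⟩
  ∑ (upTo n) f + f n  ≡⟨ cong₂ _+_ (∑-upTo-cong n (λ i i<n → f≗g i (ℕₚ.m<n⇒m<1+n i<n))) (f≗g n ℕₚ.≤-refl) ⟩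
  ∑ (upTo n) g + g n  ≡⟨ ∑-upTo-sucʳ n g ⟨
  ∑ (upTo (suc n)) g  ∎
  where open ≡-Reasoning

∑-upTo-+ : ∀ m n f → ∑ (upTo (m ℕ.+ n)) f ≡ ∑ (upTo m) f + ∑[ i ← upTo n ] f (m ℕ.+ i)
∑-upTo-+ m zero f = trans (cong (λ k → ∑ (upTo k) f) (ℕₚ.+-identityʳ m)) (sym (ℤₚ.+-identityʳ _))
∑-upTo-+ m (suc n) f = begin
  ∑ (upTo (m ℕ.+ suc n)) f
    ≡⟨ cong (λ k → ∑ (upTo k) f) (ℕₚ.+-suc m n) ⟩
  ∑ (upTo (suc (m ℕ.+ n))) f
    ≡⟨ ∑-upTo-sucʳ (m ℕ.+ n) f ⟩
  ∑ (upTo (m ℕ.+ n)) f + f (m ℕ.+ n)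
    ≡⟨ cong (_+ f (m ℕ.+ n)) (∑-upTo-+ m n f) ⟩
  ∑ (upTo m) f + ∑[ i ← upTo n ] f (m ℕ.+ i) + f (m ℕ.+ n)
    ≡⟨ ℤₚ.+-assoc (∑ (upTo m) f) _ _ ⟩
  ∑ (upTo m) f + (∑[ i ← upTo n ] f (m ℕ.+ i) + f (m ℕ.+ n))
    ≡⟨ cong (_+_ (∑ (upTo m) f)) (∑-upTo-sucʳ n (λ i → f (m ℕ.+ i))) ⟨
  ∑ (upTo m) f + ∑[ i ← upTo (suc n) ] f (m ℕ.+ i) ∎
  where open ≡-Reasoning

∑-upTo-const : ∀ n c → ∑[ _ ← upTo n ] c ≡ + n * c
∑-upTo-const zero c = sym (ℤₚ.*-zeroˡ c)
∑-upTo-const (suc n) c =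
  trans (∑-upTo-suc n (λ _ → c)) (trans (cong (_+_ c) (∑-upTo-const n c)) (sym (ℤₚ.suc-* (+ n) c)))

∑-upTo-𝟙≡ : ∀ n s g → ∑[ e ← upTo n ] (𝟙 (e ≡ᵇ s) * g e) ≡ 𝟙 (s <ᵇ n) * g s
∑-upTo-𝟙≡ zero s g = sym (ℤₚ.*-zeroˡ (g s))
∑-upTo-𝟙≡ (suc n) zero g = begin
  ∑[ e ← upTo (suc n) ] (𝟙 (e ≡ᵇ 0) * g e)
    ≡⟨ ∑-upTo-suc n (λ e → 𝟙 (e ≡ᵇ 0) * g e) ⟩
  + 1 * g 0 + ∑[ i ← upTo n ] (+ 0 * g (suc i))
    ≡⟨ cong (_+_ (+ 1 * g 0)) (trans (∑-cong (upTo n) (λ i → ℤₚ.*-zeroˡ (g (suc i)))) (∑-zero (upTo n))) ⟩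
  + 1 * g 0 + + 0
    ≡⟨ ℤₚ.+-identityʳ _ ⟩
  + 1 * g 0 ∎
  where open ≡-Reasoning
∑-upTo-𝟙≡ (suc n) (suc s) g = begin
  ∑[ e ← upTo (suc n) ] (𝟙 (e ≡ᵇ suc s) * g e)
    ≡⟨ ∑-upTo-suc n (λ e → 𝟙 (e ≡ᵇ suc s) * g e) ⟩
  + 0 * g 0 + ∑[ i ← upTo n ] (𝟙 (i ≡ᵇ s) * g (suc i))
    ≡⟨ cong (_+ ∑[ i ← upTo n ] (𝟙 (i ≡ᵇ s) * g (suc i))) (ℤₚ.*-zeroˡ (g 0)) ⟩
  + 0 + ∑[ i ← upTo n ] (𝟙 (i ≡ᵇ s) * g (suc i))
    ≡⟨ ℤₚ.+-identityˡ _ ⟩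
  ∑[ i ← upTo n ] (𝟙 (i ≡ᵇ s) * g (suc i))
    ≡⟨ ∑-upTo-𝟙≡ n s (λ i → g (suc i)) ⟩
  𝟙 (s <ᵇ n) * g (suc s) ∎
  where open ≡-Reasoning

∑-upTo-𝟙-unique : ∀ M (P : ℕ → Bool) c₀ → c₀ < M → P c₀ ≡ true →
  (∀ c → c < M → P c ≡ true → c ≡ c₀) → ∑[ c ← upTo M ] 𝟙 (P c) ≡ + 1
∑-upTo-𝟙-unique M P c₀ c₀<M Pc₀ unique = begin
  ∑[ c ← upTo M ] 𝟙 (P c)             ≡⟨ ∑-upTo-cong M only-c₀ ⟩
  ∑[ c ← upTo M ] (𝟙 (c ≡ᵇ c₀) * + 1) ≡⟨ ∑-upTo-𝟙≡ M c₀ (λ _ → + 1) ⟩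
  𝟙 (c₀ <ᵇ M) * + 1                   ≡⟨ cong (λ b → 𝟙 b * + 1) (<ᵇ≡true c₀<M) ⟩
  + 1                                 ∎
  where
  open ≡-Reasoning
  only-c₀ : ∀ c → c < M → 𝟙 (P c) ≡ 𝟙 (c ≡ᵇ c₀) * + 1
  only-c₀ c c<M with P c in Pc
  ... | true rewrite unique c c<M Pc | ≡ᵇ-refl c₀ = refl
  ... | false rewrite ≡ᵇ≡false {c} {c₀} (λ { refl → subst T Pc (subst T (sym Pc₀) _) }) = refl

∑-upTo-rotate : ∀ M .{{_ : NonZero M}} c h → c < M → ∑[ e ← upTo M ] h ((c ℕ.+ e) % M) ≡ ∑ (upTo M) h
∑-upTo-rotate M c h c<M = begin
  ∑[ e ← upTo M ] h ((c ℕ.+ e) % M)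
    ≡⟨ cong (λ n → ∑[ e ← upTo n ] h ((c ℕ.+ e) % M)) r+c≡M ⟨
  ∑[ e ← upTo (r ℕ.+ c) ] h ((c ℕ.+ e) % M)
    ≡⟨ ∑-upTo-+ r c _ ⟩
  ∑[ e ← upTo r ] h ((c ℕ.+ e) % M) + ∑[ i ← upTo c ] h ((c ℕ.+ (r ℕ.+ i)) % M)
    ≡⟨ cong₂ _+_ (∑-upTo-cong r noWrap) (∑-upTo-cong c wrap) ⟩
  ∑[ e ← upTo r ] h (c ℕ.+ e) + ∑ (upTo c) h
    ≡⟨ ℤₚ.+-comm (∑[ e ← upTo r ] h (c ℕ.+ e)) (∑ (upTo c) h) ⟩
  ∑ (upTo c) h + ∑[ e ← upTo r ] h (c ℕ.+ e)
    ≡⟨ ∑-upTo-+ c r h ⟨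
  ∑ (upTo (c ℕ.+ r)) h
    ≡⟨ cong (λ n → ∑ (upTo n) h) c+r≡M ⟩
  ∑ (upTo M) h ∎
  where
  open ≡-Reasoning
  r = M ∸ c
  r+c≡M : r ℕ.+ c ≡ M
  r+c≡M = ℕₚ.m∸n+n≡m (ℕₚ.<⇒≤ c<M)
  c+r≡M : c ℕ.+ r ≡ M
  c+r≡M = trans (ℕₚ.+-comm c r) r+c≡M
  noWrap : ∀ e → e < r → h ((c ℕ.+ e) % M) ≡ h (c ℕ.+ e)
  noWrap e e<r = cong h (m<n⇒m%n≡m (subst (c ℕ.+ e <_) c+r≡M (ℕₚ.+-monoʳ-< c e<r)))
  wrap : ∀ i → i < c → h ((c ℕ.+ (r ℕ.+ i)) % M) ≡ h i
  wrap i i<c = cong h (begin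
    (c ℕ.+ (r ℕ.+ i)) % M ≡⟨ cong (_% M) (trans (sym (ℕₚ.+-assoc c r i)) (cong (ℕ._+ i) c+r≡M)) ⟩
    (M ℕ.+ i) % M         ≡⟨ cong (_% M) (ℕₚ.+-comm M i) ⟩
    (i ℕ.+ M) % M         ≡⟨ [m+n]%n≡m%n i M ⟩
    i % M                 ≡⟨ m<n⇒m%n≡m (ℕₚ.<-trans i<c c<M) ⟩
    i                     ∎)

∑-oneTo : ∀ N f → ∑ (oneTo N) f ≡ ∑[ i ← upTo N ] f (suc i)
∑-oneTo N f = ∑-map suc (upTo N) f

∑-oneTo-sucʳ : ∀ N f → ∑ (oneTo (suc N)) f ≡ ∑ (oneTo N) f + f (suc N)
∑-oneTo-sucʳ N f = trans (∑-oneTo (suc N) f)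
  (trans (∑-upTo-sucʳ N (λ i → f (suc i))) (cong (_+ f (suc N)) (sym (∑-oneTo N f))))

∑-seqs : ∀ l k f → ∑ (seqs (suc l) k) f ≡ ∑[ a ← oneTo k ] ∑[ b ← seqs l k ] f (a ∷ b)
∑-seqs l k f = trans (∑-concatMap (λ a → map (a ∷_) (seqs l k)) (oneTo k) f)
                     (∑-cong (oneTo k) (λ a → ∑-map (a ∷_) (seqs l k) f))

∑-seqs-cong : ∀ l k {f g} → (∀ b → length b ≡ l → f b ≡ g b) → ∑ (seqs l k) f ≡ ∑ (seqs l k) g
∑-seqs-cong zero k f≗g = cong (_+ + 0) (f≗g [] refl)
∑-seqs-cong (suc l) k {f} {g} f≗g = begin
  ∑ (seqs (suc l) k) f
    ≡⟨ ∑-seqs l k f ⟩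
  ∑[ a ← oneTo k ] ∑[ b ← seqs l k ] f (a ∷ b)
    ≡⟨ ∑-cong (oneTo k) (λ a → ∑-seqs-cong l k (λ b len → f≗g (a ∷ b) (cong suc len))) ⟩
  ∑[ a ← oneTo k ] ∑[ b ← seqs l k ] g (a ∷ b)
    ≡⟨ ∑-seqs l k g ⟨
  ∑ (seqs (suc l) k) g ∎
  where open ≡-Reasoning

∑-seqs-shrink : ∀ l K f → (∀ π → length π ≡ l → ¬ All (_≤ K) π → f π ≡ + 0) →
  ∑ (seqs l (suc K)) f ≡ ∑ (seqs l K) f
∑-seqs-shrink zero K f _ = refl
∑-seqs-shrink (suc l) K f outside = begin
  ∑ (seqs (suc l) (suc K)) f
    ≡⟨ ∑-seqs l (suc K) f ⟩
  ∑[ a ← oneTo (suc K) ] ∑[ b ← seqs l (suc K) ] f (a ∷ b)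
    ≡⟨ ∑-cong (oneTo (suc K)) (λ a → ∑-seqs-shrink l K (λ b → f (a ∷ b))
         (λ π len π≰K → outside (a ∷ π) (cong suc len) (λ { (_ ∷ π≤K) → π≰K π≤K }))) ⟩
  ∑[ a ← oneTo (suc K) ] ∑[ b ← seqs l K ] f (a ∷ b)
    ≡⟨ ∑-oneTo-sucʳ K _ ⟩
  ∑[ a ← oneTo K ] ∑[ b ← seqs l K ] f (a ∷ b) + ∑[ b ← seqs l K ] f (suc K ∷ b)
    ≡⟨ cong (_+_ (∑[ a ← oneTo K ] ∑[ b ← seqs l K ] f (a ∷ b))) (trans (∑-seqs-cong l K lastLetter) (∑-zero (seqs l K))) ⟩
  ∑[ a ← oneTo K ] ∑[ b ← seqs l K ] f (a ∷ b) + + 0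
    ≡⟨ ℤₚ.+-identityʳ _ ⟩
  ∑[ a ← oneTo K ] ∑[ b ← seqs l K ] f (a ∷ b)
    ≡⟨ ∑-seqs l K f ⟨
  ∑ (seqs (suc l) K) f ∎
  where
  open ≡-Reasoning
  lastLetter : ∀ b → length b ≡ l → f (suc K ∷ b) ≡ + 0
  lastLetter b len = outside (suc K ∷ b) (cong suc len) (λ { (K+1≤K ∷ _) → ℕₚ.<-irrefl refl K+1≤K })

words : ℕ → ℕ → List (List ℕ)
words zero K = [] ∷ []
words (suc l) K = concatMap (λ a → map (a ∷_) (words l K)) (upTo K)

∑-words : ∀ l K f → ∑ (words (suc l) K) f ≡ ∑[ a ← upTo K ] ∑[ d ← words l K ] f (a ∷ d)
∑-words l K f = trans (∑-concatMap (λ a → map (a ∷_) (words l K)) (upTo K) f)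
                      (∑-cong (upTo K) (λ a → ∑-map (a ∷_) (words l K) f))

∑-words-cong : ∀ l K {f g} → (∀ d → length d ≡ l → All (_< K) d → f d ≡ g d) →
  ∑ (words l K) f ≡ ∑ (words l K) g
∑-words-cong zero K f≗g = cong (_+ + 0) (f≗g [] refl [])
∑-words-cong (suc l) K {f} {g} f≗g = begin
  ∑ (words (suc l) K) f
    ≡⟨ ∑-words l K f ⟩
  ∑[ a ← upTo K ] ∑[ d ← words l K ] f (a ∷ d)
    ≡⟨ ∑-upTo-cong K (λ a a<K → ∑-words-cong l K (λ d len d<K → f≗g (a ∷ d) (cong suc len) (a<K ∷ d<K))) ⟩
  ∑[ a ← upTo K ] ∑[ d ← words l K ] g (a ∷ d)
    ≡⟨ ∑-words l K g ⟨
  ∑ (words (suc l) K) g ∎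
  where open ≡-Reasoning

_⋆_ : (ℕ → ℤ) → (ℕ → ℤ) → ℕ → ℤ
(f ⋆ g) m = ∑[ j ← upTo (suc m) ] (f j * g (m ∸ j))

shift : ℤ → (ℕ → ℤ) → ℕ → ℤ
shift c f zero = + 0
shift c f (suc j) = c * f j

⋆-congˡ : ∀ {f f′} g m → (∀ j → f j ≡ f′ j) → (f ⋆ g) m ≡ (f′ ⋆ g) m
⋆-congˡ g m f≗f′ = ∑-cong (upTo (suc m)) (λ j → cong (_* g (m ∸ j)) (f≗f′ j))

⋆-congʳ : ∀ f {g g′} m → (∀ k → g k ≡ g′ k) → (f ⋆ g) m ≡ (f ⋆ g′) m
⋆-congʳ f m g≗g′ = ∑-cong (upTo (suc m)) (λ j → cong (f j *_) (g≗g′ (m ∸ j)))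

⋆-distribʳ-+ : ∀ f₁ f₂ g m → ((λ j → f₁ j + f₂ j) ⋆ g) m ≡ (f₁ ⋆ g) m + (f₂ ⋆ g) m
⋆-distribʳ-+ f₁ f₂ g m = trans
  (∑-cong (upTo (suc m)) (λ j → ℤₚ.*-distribʳ-+ (g (m ∸ j)) (f₁ j) (f₂ j)))
  (∑-+ (upTo (suc m)) (λ j → f₁ j * g (m ∸ j)) (λ j → f₂ j * g (m ∸ j)))

⋆-distribˡ-+ : ∀ f g₁ g₂ m → (f ⋆ (λ k → g₁ k + g₂ k)) m ≡ (f ⋆ g₁) m + (f ⋆ g₂) m
⋆-distribˡ-+ f g₁ g₂ m = trans
  (∑-cong (upTo (suc m)) (λ j → ℤₚ.*-distribˡ-+ (f j) (g₁ (m ∸ j)) (g₂ (m ∸ j))))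
  (∑-+ (upTo (suc m)) (λ j → f j * g₁ (m ∸ j)) (λ j → f j * g₂ (m ∸ j)))

⋆-shiftˡ : ∀ c f g m → (shift c f ⋆ g) (suc m) ≡ c * (f ⋆ g) m
⋆-shiftˡ c f g m = begin
  (shift c f ⋆ g) (suc m)
    ≡⟨ ∑-upTo-suc (suc m) (λ j → shift c f j * g (suc m ∸ j)) ⟩
  + 0 * g (suc m) + ∑[ j ← upTo (suc m) ] (c * f j * g (m ∸ j))
    ≡⟨ cong (_+ ∑[ j ← upTo (suc m) ] (c * f j * g (m ∸ j))) (ℤₚ.*-zeroˡ (g (suc m))) ⟩
  + 0 + ∑[ j ← upTo (suc m) ] (c * f j * g (m ∸ j))
    ≡⟨ ℤₚ.+-identityˡ _ ⟩
  ∑[ j ← upTo (suc m) ] (c * f j * g (m ∸ j))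
    ≡⟨ ∑-cong (upTo (suc m)) (λ j → ℤₚ.*-assoc c (f j) (g (m ∸ j))) ⟩
  ∑[ j ← upTo (suc m) ] (c * (f j * g (m ∸ j)))
    ≡⟨ ∑-*ˡ (upTo (suc m)) c _ ⟨
  c * (f ⋆ g) m ∎
  where open ≡-Reasoning

⋆-shiftʳ : ∀ c f g m → (f ⋆ shift c g) (suc m) ≡ c * (f ⋆ g) m
⋆-shiftʳ c f g m = begin
  (f ⋆ shift c g) (suc m)
    ≡⟨ ∑-upTo-sucʳ (suc m) (λ j → f j * shift c g (suc m ∸ j)) ⟩
  ∑[ j ← upTo (suc m) ] (f j * shift c g (suc m ∸ j)) + f (suc m) * shift c g (m ∸ m)
    ≡⟨ cong₂ _+_ (∑-upTo-cong (suc m) inner) last ⟩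
  ∑[ j ← upTo (suc m) ] (c * (f j * g (m ∸ j))) + + 0
    ≡⟨ ℤₚ.+-identityʳ _ ⟩
  ∑[ j ← upTo (suc m) ] (c * (f j * g (m ∸ j)))
    ≡⟨ ∑-*ˡ (upTo (suc m)) c _ ⟨
  c * (f ⋆ g) m ∎
  where
  open ≡-Reasoning
  swap : ∀ a b c → a * (b * c) ≡ b * (a * c)
  swap = solve-∀
  inner : ∀ j → j < suc m → f j * shift c g (suc m ∸ j) ≡ c * (f j * g (m ∸ j))
  inner j (s≤s j≤m) rewrite ℕₚ.+-∸-assoc 1 j≤m = swap (f j) c (g (m ∸ j))
  last : f (suc m) * shift c g (m ∸ m) ≡ + 0
  last = trans (cong (λ i → f (suc m) * shift c g i) (ℕₚ.n∸n≡0 m)) (ℤₚ.*-zeroʳ (f (suc m)))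

stepWeight : ℤ → ℤ → ℕ → ℕ → ℤ
stepWeight β γ t a = β * 𝟙 (t ≤ᵇ a) + γ * 𝟙 (t <ᵇ a)

chainWeight : ℤ → ℤ → ℕ → List ℕ → ℤ
chainWeight β γ t [] = + 1
chainWeight β γ t (a ∷ b) = stepWeight β γ t a * chainWeight β γ a b

wordWeight : ℤ → ℤ → List ℕ → ℤ
wordWeight β γ [] = + 1
wordWeight β γ (t ∷ b) = chainWeight β γ t b

strictInc : List ℕ → Bool
strictInc [] = true
strictInc (a ∷ []) = true
strictInc (a ∷ b ∷ l) = (a <ᵇ b) ∧ strictInc (b ∷ l)

𝟙-∧ : ∀ a b → 𝟙 (a ∧ b) ≡ 𝟙 a * 𝟙 b
𝟙-∧ true b = sym (ℤₚ.*-identityˡ (𝟙 b))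
𝟙-∧ false b = refl

mono-++ : ∀ x l k → mono x (l ++ k) ≡ mono x l * mono x k
mono-++ x [] k = sym (ℤₚ.*-identityˡ _)
mono-++ x (a ∷ l) k = trans (cong (x a *_) (mono-++ x l k)) (sym (ℤₚ.*-assoc (x a) _ _))

isSSYT-hook : ∀ t r c → isSSYT ((t ∷ r) ∷ map [_] c) ≡ weaklyInc (t ∷ r) ∧ strictInc (t ∷ c)
isSSYT-hook t r c =
  cong₂ _∧_ (trans (cong (weaklyInc (t ∷ r) ∧_) (columnRows c)) (Boolₚ.∧-identityʳ _)) (columnStrict t r c)
  where
  columnRows : ∀ c → allB weaklyInc (map [_] c) ≡ true
  columnRows [] = refl
  columnRows (a ∷ c) = columnRows c
  zipWith-[] : ∀ r → allB (λ b → b) (zipWith _<ᵇ_ r []) ≡ true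
  zipWith-[] [] = refl
  zipWith-[] (_ ∷ _) = refl
  columnStrict : ∀ t r c → colsStrict ((t ∷ r) ∷ map [_] c) ≡ strictInc (t ∷ c)
  columnStrict t r [] = refl
  columnStrict t r (a ∷ c) =
    cong₂ _∧_ (trans (cong ((t <ᵇ a) ∧_) (zipWith-[] r)) (Boolₚ.∧-identityʳ (t <ᵇ a))) (columnStrict a [] c)

module HookExpansion (N : ℕ) (x : ℕ → ℤ) where

  rowSum : ℕ → ℕ → ℤ
  rowSum j t = ∑[ r ← seqs j N ] (𝟙 (weaklyInc (t ∷ r)) * mono x r)

  columnSum : ℕ → ℕ → ℤ
  columnSum k t = ∑[ c ← seqs k N ] (𝟙 (strictInc (t ∷ c)) * mono x c)

  ∑-fillings-column : ∀ k (g : List (List ℕ) → ℤ) →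
    ∑ (fillings (replicate k 1) N) g ≡ ∑[ c ← seqs k N ] g (map [_] c)
  ∑-fillings-column zero g = refl
  ∑-fillings-column (suc k) g = begin
    ∑ (fillings (replicate (suc k) 1) N) g
      ≡⟨ ∑-concatMap (λ r → map (r ∷_) (fillings (replicate k 1) N)) (seqs 1 N) g ⟩
    ∑[ r ← seqs 1 N ] ∑ (map (r ∷_) (fillings (replicate k 1) N)) g
      ≡⟨ ∑-cong (seqs 1 N) (λ r → trans (∑-map (r ∷_) (fillings (replicate k 1) N) g)
                                         (∑-fillings-column k (λ T → g (r ∷ T)))) ⟩
    ∑[ r ← seqs 1 N ] ∑[ c ← seqs k N ] g (r ∷ map [_] c)
      ≡⟨ ∑-seqs 0 N _ ⟩
    ∑[ a ← oneTo N ] (∑[ c ← seqs k N ] g ([ a ] ∷ map [_] c) + + 0)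
      ≡⟨ ∑-cong (oneTo N) (λ a → ℤₚ.+-identityʳ _) ⟩
    ∑[ a ← oneTo N ] ∑[ c ← seqs k N ] g ([ a ] ∷ map [_] c)
      ≡⟨ ∑-seqs k N _ ⟨
    ∑[ c ← seqs (suc k) N ] g (map [_] c) ∎
    where open ≡-Reasoning

  hookTableauWeight : ∀ t r c → 𝟙 (isSSYT ((t ∷ r) ∷ map [_] c)) * mono x (concat ((t ∷ r) ∷ map [_] c))
    ≡ x t * ((𝟙 (weaklyInc (t ∷ r)) * mono x r) * (𝟙 (strictInc (t ∷ c)) * mono x c))
  hookTableauWeight t r c = begin
    𝟙 (isSSYT ((t ∷ r) ∷ map [_] c)) * (x t * mono x (r ++ concat (map [_] c)))
      ≡⟨ cong₂ (λ u v → u * (x t * v))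
           (trans (cong 𝟙 (isSSYT-hook t r c)) (𝟙-∧ (weaklyInc (t ∷ r)) (strictInc (t ∷ c))))
           (trans (mono-++ x r _) (cong (λ z → mono x r * mono x z) (Listₚ.concat-map-[_] c))) ⟩
    𝟙 (weaklyInc (t ∷ r)) * 𝟙 (strictInc (t ∷ c)) * (x t * (mono x r * mono x c))
      ≡⟨ rearrange (𝟙 (weaklyInc (t ∷ r))) (𝟙 (strictInc (t ∷ c))) (x t) (mono x r) (mono x c) ⟩
    x t * ((𝟙 (weaklyInc (t ∷ r)) * mono x r) * (𝟙 (strictInc (t ∷ c)) * mono x c)) ∎
    where
    open ≡-Reasoning
    rearrange : ∀ a b c d e → a * b * (c * (d * e)) ≡ c * ((a * d) * (b * e))
    rearrange = solve-∀

  schur-hook : ∀ j k → schur (suc j ∷ replicate k 1) N x ≡ ∑[ t ← oneTo N ] (x t * (rowSum j t * columnSum k t))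
  schur-hook j k = begin
    schur (suc j ∷ replicate k 1) N x
      ≡⟨ ∑-filter isSSYT (fillings (suc j ∷ replicate k 1) N) _ ⟩
    ∑ (fillings (suc j ∷ replicate k 1) N) h
      ≡⟨ ∑-concatMap (λ r → map (r ∷_) (fillings (replicate k 1) N)) (seqs (suc j) N) h ⟩
    ∑[ r ← seqs (suc j) N ] ∑ (map (r ∷_) (fillings (replicate k 1) N)) h
      ≡⟨ ∑-cong (seqs (suc j) N) (λ r → trans (∑-map (r ∷_) (fillings (replicate k 1) N) h)
                                               (∑-fillings-column k (λ T → h (r ∷ T)))) ⟩
    ∑[ r ← seqs (suc j) N ] ∑[ c ← seqs k N ] h (r ∷ map [_] c)
      ≡⟨ ∑-seqs j N _ ⟩
    ∑[ t ← oneTo N ] ∑[ r ← seqs j N ] ∑[ c ← seqs k N ] h ((t ∷ r) ∷ map [_] c)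
      ≡⟨ ∑-cong (oneTo N) (λ t → ∑-cong (seqs j N) (λ r → ∑-cong (seqs k N) (hookTableauWeight t r))) ⟩
    ∑[ t ← oneTo N ] ∑[ r ← seqs j N ] ∑[ c ← seqs k N ] (x t * (row t r * column t c))
      ≡⟨ ∑-cong (oneTo N) factor ⟩
    ∑[ t ← oneTo N ] (x t * (rowSum j t * columnSum k t)) ∎
    where
    open ≡-Reasoning
    h : List (List ℕ) → ℤ
    h T = 𝟙 (isSSYT T) * mono x (concat T)
    row column : ℕ → List ℕ → ℤ
    row t r = 𝟙 (weaklyInc (t ∷ r)) * mono x r
    column t c = 𝟙 (strictInc (t ∷ c)) * mono x c
    factor : ∀ t → ∑[ r ← seqs j N ] ∑[ c ← seqs k N ] (x t * (row t r * column t c))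
                   ≡ x t * (rowSum j t * columnSum k t)
    factor t = begin
      ∑[ r ← seqs j N ] ∑[ c ← seqs k N ] (x t * (row t r * column t c))
        ≡⟨ ∑-cong (seqs j N) (λ r → ∑-*ˡ (seqs k N) (x t) _) ⟨
      ∑[ r ← seqs j N ] (x t * ∑[ c ← seqs k N ] (row t r * column t c))
        ≡⟨ ∑-*ˡ (seqs j N) (x t) _ ⟨
      x t * ∑[ r ← seqs j N ] ∑[ c ← seqs k N ] (row t r * column t c)
        ≡⟨ cong (x t *_) (∑-*-∑ (seqs j N) (seqs k N) (row t) (column t)) ⟨
      x t * (rowSum j t * columnSum k t) ∎

  xᴺ : ℕ → ℤ
  xᴺ a = 𝟙 (a ≤ᵇ N) * x a

  tailSum : ℕ → (ℕ → ℤ) → ℤ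
  tailSum t f = ∑[ a ← oneTo N ] (𝟙 (t <ᵇ a) * (x a * f a))

  tailSum-suc : ∀ t f → tailSum t f ≡ xᴺ (suc t) * f (suc t) + tailSum (suc t) f
  tailSum-suc t f = begin
    tailSum t f
      ≡⟨ ∑-cong (oneTo N) (λ a → trans (cong (_* (x a * f a)) (split t a))
                                       (ℤₚ.*-distribʳ-+ (x a * f a) (𝟙 (a ≡ᵇ suc t)) _)) ⟩
    ∑[ a ← oneTo N ] (𝟙 (a ≡ᵇ suc t) * (x a * f a) + 𝟙 (suc t <ᵇ a) * (x a * f a))
      ≡⟨ ∑-+ (oneTo N) (λ a → 𝟙 (a ≡ᵇ suc t) * (x a * f a)) (λ a → 𝟙 (suc t <ᵇ a) * (x a * f a)) ⟩
    ∑[ a ← oneTo N ] (𝟙 (a ≡ᵇ suc t) * (x a * f a)) + tailSum (suc t) f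
      ≡⟨ cong (_+ tailSum (suc t) f) (trans (∑-oneTo N _) (∑-upTo-𝟙≡ N t (λ i → x (suc i) * f (suc i)))) ⟩
    𝟙 (t <ᵇ N) * (x (suc t) * f (suc t)) + tailSum (suc t) f
      ≡⟨ cong (_+ tailSum (suc t) f) (ℤₚ.*-assoc (𝟙 (t <ᵇ N)) _ _) ⟨
    xᴺ (suc t) * f (suc t) + tailSum (suc t) f ∎
    where
    open ≡-Reasoning
    split : ∀ t a → 𝟙 (t <ᵇ a) ≡ 𝟙 (a ≡ᵇ suc t) + 𝟙 (suc t <ᵇ a)
    split t zero = refl
    split zero (suc zero) = refl
    split zero (suc (suc a)) = refl
    split (suc t) (suc a) = split t a

  tailSum-vanishes : ∀ t f → N ≤ t → tailSum t f ≡ + 0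
  tailSum-vanishes t f N≤t = trans (∑-oneTo N _) (trans (∑-upTo-cong N beyond) (∑-zero (upTo N)))
    where
    beyond : ∀ i → i < N → 𝟙 (t <ᵇ suc i) * (x (suc i) * f (suc i)) ≡ + 0
    beyond i i<N rewrite <ᵇ≡false {t} {suc i} (ℕₚ.≤-trans i<N N≤t) = ℤₚ.*-zeroˡ (x (suc i) * f (suc i))

  ∑-seqs-suc : ∀ m (G : List ℕ → ℤ) (φ : ℕ → ℤ) (F : ℕ → List ℕ → ℤ) →
    (∀ a r → G (a ∷ r) ≡ φ a * (x a * F a r)) →
    ∑ (seqs (suc m) N) G ≡ ∑[ a ← oneTo N ] (φ a * (x a * ∑ (seqs m N) (F a)))
  ∑-seqs-suc m G φ F G≗φxF = trans (∑-seqs m N G) (∑-cong (oneTo N) (λ a → begin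
    ∑[ r ← seqs m N ] G (a ∷ r)              ≡⟨ ∑-cong (seqs m N) (G≗φxF a) ⟩
    ∑[ r ← seqs m N ] (φ a * (x a * F a r))  ≡⟨ ∑-*ˡ (seqs m N) (φ a) _ ⟨
    φ a * ∑[ r ← seqs m N ] (x a * F a r)    ≡⟨ cong (φ a *_) (∑-*ˡ (seqs m N) (x a) (F a)) ⟨
    φ a * (x a * ∑ (seqs m N) (F a))         ∎))
    where open ≡-Reasoning

  regroup : ∀ p q y m → p * q * (y * m) ≡ p * (y * (q * m))
  regroup = solve-∀

  rowSum-suc : ∀ j s → rowSum (suc j) (suc s) ≡ tailSum s (rowSum j)
  rowSum-suc j s = ∑-seqs-suc j _ (λ a → 𝟙 (s <ᵇ a)) (λ a r → 𝟙 (weaklyInc (a ∷ r)) * mono x r)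
    (λ a r → trans (cong (_* mono x (a ∷ r)) (𝟙-∧ (s <ᵇ a) (weaklyInc (a ∷ r))))
                   (regroup (𝟙 (s <ᵇ a)) (𝟙 (weaklyInc (a ∷ r))) (x a) (mono x r)))

  columnSum-suc : ∀ k t → columnSum (suc k) t ≡ tailSum t (columnSum k)
  columnSum-suc k t = ∑-seqs-suc k _ (λ a → 𝟙 (t <ᵇ a)) (λ a c → 𝟙 (strictInc (a ∷ c)) * mono x c)
    (λ a c → trans (cong (_* mono x (a ∷ c)) (𝟙-∧ (t <ᵇ a) (strictInc (a ∷ c))))
                   (regroup (𝟙 (t <ᵇ a)) (𝟙 (strictInc (a ∷ c))) (x a) (mono x c)))

  rowSum-step : ∀ j s → rowSum (suc j) (suc s) ≡ xᴺ (suc s) * rowSum j (suc s) + rowSum (suc j) (suc (suc s))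
  rowSum-step j s = trans (rowSum-suc j s) (trans (tailSum-suc s (rowSum j))
    (cong (_+_ (xᴺ (suc s) * rowSum j (suc s))) (sym (rowSum-suc j (suc s)))))

  columnSum-step : ∀ k t → columnSum (suc k) t ≡ xᴺ (suc t) * columnSum k (suc t) + columnSum (suc k) (suc t)
  columnSum-step k t = trans (columnSum-suc k t) (trans (tailSum-suc t (columnSum k))
    (cong (_+_ (xᴺ (suc t) * columnSum k (suc t))) (sym (columnSum-suc k (suc t)))))

  module _ (β γ : ℤ) where

    hookStep : (ℕ → ℕ → ℤ) → ℕ → ℕ → ℤ
    hookStep X m s = β * (xᴺ (suc s) * X m (suc s)) + γ * (xᴺ (suc (suc s)) * X m (suc (suc s))) + X (suc m) (suc (suc s))

    record SatisfiesHookRecurrence (X : ℕ → ℕ → ℤ) : Set where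
      field
        initial : ∀ t → X 0 t ≡ + 1
        vanishing : ∀ m s → N ≤ s → X (suc m) (suc s) ≡ + 0
        step : ∀ m s → X (suc m) (suc s) ≡ hookStep X m s

    hookRecurrence-unique : ∀ {X Y} → SatisfiesHookRecurrence X → SatisfiesHookRecurrence Y →
      ∀ s m → X m (suc s) ≡ Y m (suc s)
    hookRecurrence-unique {X} {Y} RX RY = downwardInduction (λ s → ∀ m → X m (suc s) ≡ Y m (suc s)) N base next
      where
      open SatisfiesHookRecurrence
      base : ∀ s → N ≤ s → ∀ m → X m (suc s) ≡ Y m (suc s)
      base s _ zero = trans (initial RX (suc s)) (sym (initial RY (suc s)))
      base s N≤s (suc m) = trans (vanishing RX m s N≤s) (sym (vanishing RY m s N≤s))
      next : ∀ s → (∀ m → X m (suc (suc s)) ≡ Y m (suc (suc s))) → ∀ m → X m (suc s) ≡ Y m (suc s)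
      next s _ zero = trans (initial RX (suc s)) (sym (initial RY (suc s)))
      next s X≗Y (suc m) = begin
        X (suc m) (suc s) ≡⟨ step RX m s ⟩
        hookStep X m s    ≡⟨ cong₂ _+_ (cong₂ (λ u v → β * (xᴺ (suc s) * u) + γ * (xᴺ (suc (suc s)) * v))
                                               (next s X≗Y m) (X≗Y m))
                                       (X≗Y (suc m)) ⟩
        hookStep Y m s    ≡⟨ step RY m s ⟨
        Y (suc m) (suc s) ∎
        where open ≡-Reasoning

    weightedSum : ℕ → ℕ → ℤ
    weightedSum m t = ∑[ b ← seqs m N ] (mono x b * chainWeight β γ t b)

    weightedSum-suc : ∀ m s →
      weightedSum (suc m) (suc s) ≡ β * tailSum s (weightedSum m) + γ * tailSum (suc s) (weightedSum m)
    weightedSum-suc m s = begin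
      weightedSum (suc m) (suc s)
        ≡⟨ ∑-seqs-suc m _ (stepWeight β γ (suc s)) (λ a b → mono x b * chainWeight β γ a b)
             (λ a b → rearrange (x a) (mono x b) (stepWeight β γ (suc s) a) (chainWeight β γ a b)) ⟩
      ∑[ a ← oneTo N ] (stepWeight β γ (suc s) a * W a)
        ≡⟨ ∑-cong (oneTo N) (λ a → distrib β γ (𝟙 (s <ᵇ a)) (𝟙 (suc s <ᵇ a)) (W a)) ⟩
      ∑[ a ← oneTo N ] (β * (𝟙 (s <ᵇ a) * W a) + γ * (𝟙 (suc s <ᵇ a) * W a))
        ≡⟨ ∑-+ (oneTo N) _ _ ⟩
      ∑[ a ← oneTo N ] (β * (𝟙 (s <ᵇ a) * W a)) + ∑[ a ← oneTo N ] (γ * (𝟙 (suc s <ᵇ a) * W a))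
        ≡⟨ cong₂ _+_ (∑-*ˡ (oneTo N) β _) (∑-*ˡ (oneTo N) γ _) ⟨
      β * tailSum s (weightedSum m) + γ * tailSum (suc s) (weightedSum m) ∎
      where
      open ≡-Reasoning
      W : ℕ → ℤ
      W a = x a * weightedSum m a
      rearrange : ∀ a b c d → a * b * (c * d) ≡ c * (a * (b * d))
      rearrange = solve-∀
      distrib : ∀ b g p q y → (b * p + g * q) * y ≡ b * (p * y) + g * (q * y)
      distrib = solve-∀

    weightedSum-vanishes : ∀ m s → N ≤ s → weightedSum (suc m) (suc s) ≡ + 0
    weightedSum-vanishes m s N≤s = begin
      weightedSum (suc m) (suc s)
        ≡⟨ weightedSum-suc m s ⟩
      β * tailSum s (weightedSum m) + γ * tailSum (suc s) (weightedSum m)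
        ≡⟨ cong₂ (λ u v → β * u + γ * v) (tailSum-vanishes s _ N≤s) (tailSum-vanishes (suc s) _ (ℕₚ.m≤n⇒m≤1+n N≤s)) ⟩
      β * + 0 + γ * + 0
        ≡⟨ cong₂ _+_ (ℤₚ.*-zeroʳ β) (ℤₚ.*-zeroʳ γ) ⟩
      + 0 ∎
      where open ≡-Reasoning

    weightedSum-step : ∀ m s → weightedSum (suc m) (suc s) ≡ hookStep weightedSum m s
    weightedSum-step m s = begin
      weightedSum (suc m) (suc s)
        ≡⟨ weightedSum-suc m s ⟩
      β * tailSum s W + γ * tailSum (suc s) W
        ≡⟨ cong₂ (λ u v → β * u + γ * v) (tailSum-suc s W) (tailSum-suc (suc s) W) ⟩
      β * (xᴺ (suc s) * W (suc s) + tailSum (suc s) W) + γ * (xᴺ (suc (suc s)) * W (suc (suc s)) + tailSum (suc (suc s)) W)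
        ≡⟨ regroup₂ β γ _ _ _ _ ⟩
      β * (xᴺ (suc s) * W (suc s)) + γ * (xᴺ (suc (suc s)) * W (suc (suc s))) + (β * tailSum (suc s) W + γ * tailSum (suc (suc s)) W)
        ≡⟨ cong (_+_ (β * (xᴺ (suc s) * W (suc s)) + γ * (xᴺ (suc (suc s)) * W (suc (suc s))))) (weightedSum-suc m (suc s)) ⟨
      hookStep weightedSum m s ∎
      where
      open ≡-Reasoning
      W = weightedSum m
      regroup₂ : ∀ b g p u q v → b * (p + u) + g * (q + v) ≡ b * p + g * q + (b * u + g * v)
      regroup₂ = solve-∀

    rowTerm columnTerm : ℕ → ℕ → ℤ
    rowTerm t j = β ^ j * rowSum j t
    columnTerm t k = γ ^ k * columnSum k t

    hookPolynomial : ℕ → ℕ → ℤ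
    hookPolynomial m t = (rowTerm t ⋆ columnTerm t) m

    scaleStep : ∀ b p h r r₂ → b * p * (h * r + r₂) ≡ b * h * (p * r) + b * p * r₂
    scaleStep = solve-∀

    rowTerm-step : ∀ s j → rowTerm (suc s) j ≡ shift (β * xᴺ (suc s)) (rowTerm (suc s)) j + rowTerm (suc (suc s)) j
    rowTerm-step s zero = refl
    rowTerm-step s (suc j) = trans (cong (β ^ suc j *_) (rowSum-step j s))
      (scaleStep β (β ^ j) (xᴺ (suc s)) (rowSum j (suc s)) (rowSum (suc j) (suc (suc s))))

    columnTerm-step : ∀ t k → columnTerm t k ≡ shift (γ * xᴺ (suc t)) (columnTerm (suc t)) k + columnTerm (suc t) k
    columnTerm-step t zero = refl
    columnTerm-step t (suc k) = trans (cong (γ ^ suc k *_) (columnSum-step k t))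
      (scaleStep γ (γ ^ k) (xᴺ (suc t)) (columnSum k (suc t)) (columnSum (suc k) (suc t)))

    rowTerm-vanishes : ∀ s j → N ≤ s → rowTerm (suc s) (suc j) ≡ + 0
    rowTerm-vanishes s j N≤s = trans (cong (β ^ suc j *_) (trans (rowSum-suc j s) (tailSum-vanishes s (rowSum j) N≤s)))
                                     (ℤₚ.*-zeroʳ (β ^ suc j))

    columnTerm-vanishes : ∀ t k → N ≤ t → columnTerm t (suc k) ≡ + 0
    columnTerm-vanishes t k N≤t = trans (cong (γ ^ suc k *_) (trans (columnSum-suc k t) (tailSum-vanishes t (columnSum k) N≤t)))
                                        (ℤₚ.*-zeroʳ (γ ^ suc k))

    hookPolynomial-vanishes : ∀ m s → N ≤ s → hookPolynomial (suc m) (suc s) ≡ + 0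
    hookPolynomial-vanishes m s N≤s = begin
      hookPolynomial (suc m) t
        ≡⟨ ∑-upTo-suc (suc m) (λ j → rowTerm t j * columnTerm t (suc m ∸ j)) ⟩
      rowTerm t 0 * columnTerm t (suc m) + ∑[ j ← upTo (suc m) ] (rowTerm t (suc j) * columnTerm t (m ∸ j))
        ≡⟨ cong₂ _+_ first (trans (∑-upTo-cong (suc m) (λ j _ → rest j)) (∑-zero (upTo (suc m)))) ⟩
      + 0 ∎
      where
      open ≡-Reasoning
      t = suc s
      first : rowTerm t 0 * columnTerm t (suc m) ≡ + 0
      first = trans (cong (rowTerm t 0 *_) (columnTerm-vanishes t m (ℕₚ.m≤n⇒m≤1+n N≤s))) (ℤₚ.*-zeroʳ (rowTerm t 0))
      rest : ∀ j → rowTerm t (suc j) * columnTerm t (m ∸ j) ≡ + 0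
      rest j = trans (cong (_* columnTerm t (m ∸ j)) (rowTerm-vanishes s j N≤s)) (ℤₚ.*-zeroˡ (columnTerm t (m ∸ j)))

    hookPolynomial-step : ∀ m s → hookPolynomial (suc m) (suc s) ≡ hookStep hookPolynomial m s
    hookPolynomial-step m s = begin
      hookPolynomial (suc m) t
        ≡⟨ ⋆-congˡ (columnTerm t) (suc m) (rowTerm-step s) ⟩
      ((λ j → shift (β * xᴺ t) (rowTerm t) j + rowTerm t₂ j) ⋆ columnTerm t) (suc m)
        ≡⟨ ⋆-distribʳ-+ (shift (β * xᴺ t) (rowTerm t)) (rowTerm t₂) (columnTerm t) (suc m) ⟩
      (shift (β * xᴺ t) (rowTerm t) ⋆ columnTerm t) (suc m) + (rowTerm t₂ ⋆ columnTerm t) (suc m)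
        ≡⟨ cong₂ _+_ (⋆-shiftˡ (β * xᴺ t) (rowTerm t) (columnTerm t) m) (⋆-congʳ (rowTerm t₂) (suc m) (columnTerm-step t)) ⟩
      β * xᴺ t * hookPolynomial m t + (rowTerm t₂ ⋆ (λ k → shift (γ * xᴺ t₂) (columnTerm t₂) k + columnTerm t₂ k)) (suc m)
        ≡⟨ cong (_+_ (β * xᴺ t * hookPolynomial m t))
                (⋆-distribˡ-+ (rowTerm t₂) (shift (γ * xᴺ t₂) (columnTerm t₂)) (columnTerm t₂) (suc m)) ⟩
      β * xᴺ t * hookPolynomial m t + ((rowTerm t₂ ⋆ shift (γ * xᴺ t₂) (columnTerm t₂)) (suc m) + hookPolynomial (suc m) t₂)
        ≡⟨ cong (λ z → β * xᴺ t * hookPolynomial m t + (z + hookPolynomial (suc m) t₂))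
                (⋆-shiftʳ (γ * xᴺ t₂) (rowTerm t₂) (columnTerm t₂) m) ⟩
      β * xᴺ t * hookPolynomial m t + (γ * xᴺ t₂ * hookPolynomial m t₂ + hookPolynomial (suc m) t₂)
        ≡⟨ reassociate β (xᴺ t) (hookPolynomial m t) γ (xᴺ t₂) (hookPolynomial m t₂) (hookPolynomial (suc m) t₂) ⟩
      hookStep hookPolynomial m s ∎
      where
      open ≡-Reasoning
      t = suc s
      t₂ = suc (suc s)
      reassociate : ∀ b h q g h₂ q₂ r → b * h * q + (g * h₂ * q₂ + r) ≡ b * (h * q) + g * (h₂ * q₂) + r
      reassociate = solve-∀

    weightedSum≡hookPolynomial : ∀ s m → weightedSum m (suc s) ≡ hookPolynomial m (suc s)
    weightedSum≡hookPolynomial = hookRecurrence-unique {weightedSum} {hookPolynomial}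
      (record { initial = λ _ → refl ; vanishing = weightedSum-vanishes ; step = weightedSum-step })
      (record { initial = λ _ → refl ; vanishing = hookPolynomial-vanishes ; step = hookPolynomial-step })

    ∑-hookTerms : ∀ m j → ∑[ t ← oneTo N ] (x t * (rowTerm t j * columnTerm t (m ∸ j)))
                         ≡ γ ^ (m ∸ j) * (β ^ j * schur (hook (suc m) (suc j)) N x)
    ∑-hookTerms m j = begin
      ∑[ t ← oneTo N ] (x t * (rowTerm t j * columnTerm t (m ∸ j)))
        ≡⟨ ∑-cong (oneTo N) (λ t → powers (γ ^ (m ∸ j)) (β ^ j) (x t) (rowSum j t) (columnSum (m ∸ j) t)) ⟩
      ∑[ t ← oneTo N ] (γ ^ (m ∸ j) * (β ^ j * (x t * (rowSum j t * columnSum (m ∸ j) t))))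
        ≡⟨ ∑-*ˡ (oneTo N) (γ ^ (m ∸ j)) _ ⟨
      γ ^ (m ∸ j) * ∑[ t ← oneTo N ] (β ^ j * (x t * (rowSum j t * columnSum (m ∸ j) t)))
        ≡⟨ cong (γ ^ (m ∸ j) *_) (∑-*ˡ (oneTo N) (β ^ j) _) ⟨
      γ ^ (m ∸ j) * (β ^ j * ∑[ t ← oneTo N ] (x t * (rowSum j t * columnSum (m ∸ j) t)))
        ≡⟨ cong (λ s → γ ^ (m ∸ j) * (β ^ j * s)) (schur-hook j (m ∸ j)) ⟨
      γ ^ (m ∸ j) * (β ^ j * schur (hook (suc m) (suc j)) N x) ∎
      where
      open ≡-Reasoning
      powers : ∀ g b xt r c → xt * (b * r * (g * c)) ≡ g * (b * (xt * (r * c)))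
      powers = solve-∀

    hookExpansion : ∀ m → ∑[ b ← seqs (suc m) N ] (mono x b * wordWeight β γ b)
                        ≡ sumOneTo (suc m) (λ i → γ ^ (suc m ∸ i) * (β ^ (i ∸ 1) * schur (hook (suc m) i) N x))
    hookExpansion m = begin
      ∑[ b ← seqs (suc m) N ] (mono x b * wordWeight β γ b)
        ≡⟨ ∑-seqs-suc m _ (λ _ → + 1) (λ t b → mono x b * chainWeight β γ t b) (λ t b → firstLetter (x t) (mono x b) _) ⟩
      ∑[ t ← oneTo N ] (+ 1 * (x t * weightedSum m t))
        ≡⟨ ∑-cong (oneTo N) (λ t → ℤₚ.*-identityˡ _) ⟩
      ∑[ t ← oneTo N ] (x t * weightedSum m t)
        ≡⟨ ∑-oneTo N _ ⟩
      ∑[ i ← upTo N ] (x (suc i) * weightedSum m (suc i))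
        ≡⟨ ∑-cong (upTo N) (λ i → cong (x (suc i) *_) (weightedSum≡hookPolynomial i m)) ⟩
      ∑[ i ← upTo N ] (x (suc i) * hookPolynomial m (suc i))
        ≡⟨ ∑-oneTo N _ ⟨
      ∑[ t ← oneTo N ] (x t * hookPolynomial m t)
        ≡⟨ ∑-cong (oneTo N) (λ t → ∑-*ˡ (upTo (suc m)) (x t) _) ⟩
      ∑[ t ← oneTo N ] ∑[ j ← upTo (suc m) ] (x t * (rowTerm t j * columnTerm t (m ∸ j)))
        ≡⟨ ∑-comm (oneTo N) (upTo (suc m)) _ ⟩
      ∑[ j ← upTo (suc m) ] ∑[ t ← oneTo N ] (x t * (rowTerm t j * columnTerm t (m ∸ j)))
        ≡⟨ ∑-cong (upTo (suc m)) (∑-hookTerms m) ⟩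
      ∑[ j ← upTo (suc m) ] (γ ^ (m ∸ j) * (β ^ j * schur (hook (suc m) (suc j)) N x))
        ≡⟨ ∑-oneTo (suc m) (λ i → γ ^ (suc m ∸ i) * (β ^ (i ∸ 1) * schur (hook (suc m) i) N x)) ⟨
      sumOneTo (suc m) (λ i → γ ^ (suc m ∸ i) * (β ^ (i ∸ 1) * schur (hook (suc m) i) N x)) ∎
      where
      open ≡-Reasoning
      firstLetter : ∀ xt m w → xt * m * w ≡ + 1 * (xt * (m * w))
      firstLetter = solve-∀

∣m-n∣<M⇒≡ : ∀ {M e k} → e < M → k < M → + M ∣ (+ e - + k) → e ≡ k
∣m-n∣<M⇒≡ {M} {e} {k} e<M k<M M∣e-k with ∣ + e - + k ∣ in ∣e-k∣≡
... | zero = ℤₚ.+-injective (ℤₚ.i-j≡0⇒i≡j (+ e) (+ k) (ℤₚ.∣i∣≡0⇒i≡0 ∣e-k∣≡))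
... | suc s = ⊥-elim (ℕₚ.<⇒≱ ∣e-k∣<M (ℕ∣.∣⇒≤ (subst (M ℕ∣.∣_) ∣e-k∣≡ (∣⇒∣ᵤ M∣e-k))))
  where
  ∣e-k∣<M : suc s < M
  ∣e-k∣<M = subst (_< M) ∣e-k∣≡ (ℕₚ.≤-<-trans
    (subst (λ z → ∣ z ∣ ≤ e ℕ.⊔ k) (sym (ℤₚ.m-n≡m⊖n e k)) (ℤₚ.∣m⊝n∣≤m⊔n e k)) (ℕₚ.⊔-lub e<M k<M))

module DifferenceWords (M-1 : ℕ) where
  open CycleLemma M-1
  open ParkingFunctions using (isPPF⇒PrimeParking)

  ∑-seqs-walk : ∀ k c (g : List ℕ → ℤ) → c < M →
    ∑ (seqs k M) g ≡ ∑[ d ← words k M ] g (map suc (steps c d))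
  ∑-seqs-walk zero c g c<M = refl
  ∑-seqs-walk (suc k) c g c<M = begin
    ∑ (seqs (suc k) M) g
      ≡⟨ ∑-seqs k M g ⟩
    ∑[ a ← oneTo M ] ∑[ b ← seqs k M ] g (a ∷ b)
      ≡⟨ ∑-oneTo M (λ a → ∑[ b ← seqs k M ] g (a ∷ b)) ⟩
    ∑[ a ← upTo M ] ∑[ b ← seqs k M ] g (suc a ∷ b)
      ≡⟨ ∑-upTo-cong M (λ a a<M → ∑-seqs-walk k a (λ b → g (suc a ∷ b)) a<M) ⟩
    ∑ (upTo M) continue
      ≡⟨ ∑-upTo-rotate M c continue c<M ⟨
    ∑[ e ← upTo M ] continue (rot e c)
      ≡⟨ ∑-words k M _ ⟨
    ∑[ d ← words (suc k) M ] g (map suc (steps c d)) ∎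
    where
    open ≡-Reasoning
    continue : ℕ → ℤ
    continue a = ∑[ d ← words k M ] g (suc a ∷ map suc (steps a d))

  walkGap : ℕ → ℕ → ℕ → ℤ
  walkGap c e k = (+ suc (rot e c) - + suc c) - + k

  walkGap+multiple : ∀ c e k → walkGap c e k + + ((c ℕ.+ e) / M) * + M ≡ + e - + k
  walkGap+multiple c e k = begin
    (+ 1 + B - (+ 1 + C)) - + k + Q * + M ≡⟨ shuffle B C (+ k) Q (+ M) ⟩
    B + Q * + M - C - + k                 ≡⟨ cong (λ s → s - C - + k) division ⟨
    C + + e - C - + k                     ≡⟨ cancel C (+ e) (+ k) ⟩
    + e - + k                             ∎
    where
    open ≡-Reasoning
    B = + rot e c
    C = + c
    Q = + ((c ℕ.+ e) / M)
    division : C + + e ≡ B + Q * + M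
    division = trans (sym (ℤₚ.pos-+ c e)) (trans (cong +_ (m≡m%n+[m/n]*n (c ℕ.+ e) M))
      (trans (ℤₚ.pos-+ (rot e c) _) (cong (_+_ B) (ℤₚ.pos-* ((c ℕ.+ e) / M) M))))
    shuffle : ∀ b c k q m → (+ 1 + b - (+ 1 + c)) - k + q * m ≡ b + q * m - c - k
    shuffle = solve-∀
    cancel : ∀ c e k → c + e - c - k ≡ e - k
    cancel = solve-∀

  fwdDiff-walk : ∀ c e k → e < M → k < M → fwdDiff (suc M) k (suc c) (suc (rot e c)) ≡ (e ≡ᵇ k)
  fwdDiff-walk c e k e<M k<M with e ℕ.≟ k
  ... | yes refl rewrite ≡ᵇ-refl e = dec-true (+ M ∣? walkGap c e e)
    (∣m+n∣n⇒∣m (subst (+ M ∣_) (sym (walkGap+multiple c e e)) M∣e-e) M∣multiple)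
    where
    M∣e-e = divides (+ 0) (ℤₚ.+-inverseʳ (+ e))
    M∣multiple = ∣n⇒∣m*n (+ ((c ℕ.+ e) / M)) ∣-refl
  ... | no e≢k rewrite ≡ᵇ≡false e≢k = dec-false (+ M ∣? walkGap c e k) (λ M∣gap →
    e≢k (∣m-n∣<M⇒≡ e<M k<M (subst (+ M ∣_) (walkGap+multiple c e k) (∣m∣n⇒∣m+n M∣gap M∣multiple))))
    where
    M∣multiple = ∣n⇒∣m*n (+ ((c ℕ.+ e) / M)) ∣-refl

  diffList-walk : ∀ k c d → k < M → All (_< M) d →
    diffList (suc M) k (map suc (walk c d)) ≡ map (_≡ᵇ k) d
  diffList-walk k c [] _ [] = refl
  diffList-walk k c (e ∷ d) k<M (e<M ∷ d<M) =
    cong₂ _∷_ (fwdDiff-walk c e k e<M k<M) (diffList-walk k (rot e c) d k<M d<M)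

  isPPF-walk : ℕ → List ℕ → Bool
  isPPF-walk c d = isPPF (map suc (walk c d))

  ∑-PPF : ∀ (H : List ℕ → ℤ) →
    ∑ (PPF (suc M)) H ≡ ∑[ d ← words M M ] ∑[ c ← upTo M ] (𝟙 (isPPF-walk c d) * H (map suc (walk c d)))
  ∑-PPF H = begin
    ∑ (PPF (suc M)) H
      ≡⟨ ∑-filter isPPF (seqs (suc M) (suc M)) H ⟩
    ∑ (seqs (suc M) (suc M)) f
      ≡⟨ ∑-seqs-shrink (suc M) M f outside ⟩
    ∑ (seqs (suc M) M) f
      ≡⟨ ∑-seqs M M f ⟩
    ∑[ a ← oneTo M ] ∑[ b ← seqs M M ] f (a ∷ b)
      ≡⟨ ∑-oneTo M (λ a → ∑[ b ← seqs M M ] f (a ∷ b)) ⟩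
    ∑[ c ← upTo M ] ∑[ b ← seqs M M ] f (suc c ∷ b)
      ≡⟨ ∑-upTo-cong M (λ c c<M → ∑-seqs-walk M c (λ b → f (suc c ∷ b)) c<M) ⟩
    ∑[ c ← upTo M ] ∑[ d ← words M M ] f (map suc (walk c d))
      ≡⟨ ∑-comm (upTo M) (words M M) (λ c d → f (map suc (walk c d))) ⟩
    ∑[ d ← words M M ] ∑[ c ← upTo M ] f (map suc (walk c d)) ∎
    where
    open ≡-Reasoning
    f : List ℕ → ℤ
    f π = 𝟙 (isPPF π) * H π
    outside : ∀ π → length π ≡ suc M → ¬ All (_≤ M) π → f π ≡ + 0
    outside π len π≰M with isPPF π in ppf
    ... | true = ⊥-elim (π≰M (proj₁ (proj₂ (isPPF⇒PrimeParking M π (s≤s z≤n) len ppf))))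
    ... | false = ℤₚ.*-zeroˡ (H π)

  exactlyOneRotation : ∀ d → length d ≡ M → ∑[ c ← upTo M ] 𝟙 (isPPF-walk c d) ≡ + 1
  exactlyOneRotation d len with c₀ , c₀<M , ppf₀ , unique ← cycleLemma d len =
    ∑-upTo-𝟙-unique M (λ c → isPPF-walk c d) c₀ c₀<M ppf₀ unique

  ∑-PPF-differences : ∀ (H G : List ℕ → ℤ) → (∀ c d → c < M → All (_< M) d → H (map suc (walk c d)) ≡ G d) →
    ∑ (PPF (suc M)) H ≡ ∑ (words M M) G
  ∑-PPF-differences H G H≡G = trans (∑-PPF H) (∑-words-cong M M (λ d len d<M → begin
    ∑[ c ← upTo M ] (𝟙 (isPPF-walk c d) * H (map suc (walk c d)))
      ≡⟨ ∑-upTo-cong M (λ c c<M → cong (𝟙 (isPPF-walk c d) *_) (H≡G c d c<M d<M)) ⟩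
    ∑[ c ← upTo M ] (𝟙 (isPPF-walk c d) * G d)
      ≡⟨ ∑-*ʳ (upTo M) (G d) (λ c → 𝟙 (isPPF-walk c d)) ⟨
    ∑[ c ← upTo M ] 𝟙 (isPPF-walk c d) * G d
      ≡⟨ cong (_* G d) (exactlyOneRotation d len) ⟩
    + 1 * G d
      ≡⟨ ℤₚ.*-identityˡ (G d) ⟩
    G d ∎))
    where open ≡-Reasoning

  differenceFactor : ℤ → ℕ → ℕ → ℤ
  differenceFactor q ℓ e = if e ≡ᵇ ℓ then q else + 1

  -- For fixed letters t = b_i and a = b_{i+1}, the sum over the value e of the i-th difference d_i.
  LocalSum : ℤ → ℕ → ℕ → ℤ → ℤ → Set
  LocalSum q ℓ k β γ = ∀ t a →
    ∑[ e ← upTo M ] (differenceFactor q ℓ e * 𝟙 (if e ≡ᵇ k then t <ᵇ a else t ≤ᵇ a)) ≡ stepWeight β γ t a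

  ∑-upTo-𝟙≡-const : ∀ s D → s < M → ∑[ e ← upTo M ] (𝟙 (e ≡ᵇ s) * D) ≡ D
  ∑-upTo-𝟙≡-const s D s<M =
    trans (∑-upTo-𝟙≡ M s (λ _ → D)) (trans (cong (λ b → 𝟙 b * D) (<ᵇ≡true s<M)) (ℤₚ.*-identityˡ D))

  localSum-same : ∀ q ℓ → ℓ < M → LocalSum q ℓ ℓ (+ M-1) q
  localSum-same q ℓ ℓ<M t a = begin
    ∑[ e ← upTo M ] (differenceFactor q ℓ e * 𝟙 (if e ≡ᵇ ℓ then X else Y))
      ≡⟨ ∑-cong (upTo M) pointwise ⟩
    ∑[ e ← upTo M ] (𝟙 Y + 𝟙 (e ≡ᵇ ℓ) * D)
      ≡⟨ ∑-+ (upTo M) (λ _ → 𝟙 Y) (λ e → 𝟙 (e ≡ᵇ ℓ) * D) ⟩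
    ∑[ _ ← upTo M ] 𝟙 Y + ∑[ e ← upTo M ] (𝟙 (e ≡ᵇ ℓ) * D)
      ≡⟨ cong₂ _+_ (∑-upTo-const M (𝟙 Y)) (∑-upTo-𝟙≡-const ℓ D ℓ<M) ⟩
    (+ 1 + + M-1) * 𝟙 Y + D
      ≡⟨ collect (+ M-1) q (𝟙 X) (𝟙 Y) ⟩
    + M-1 * 𝟙 Y + q * 𝟙 X ∎
    where
    open ≡-Reasoning
    X = t <ᵇ a
    Y = t ≤ᵇ a
    D = q * 𝟙 X - 𝟙 Y
    on-ℓ : ∀ q x y → q * x ≡ y + + 1 * (q * x - y)
    on-ℓ = solve-∀
    off-ℓ : ∀ q x y → + 1 * y ≡ y + + 0 * (q * x - y)
    off-ℓ = solve-∀
    pointwise : ∀ e → differenceFactor q ℓ e * 𝟙 (if e ≡ᵇ ℓ then X else Y) ≡ 𝟙 Y + 𝟙 (e ≡ᵇ ℓ) * D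
    pointwise e with e ≡ᵇ ℓ
    ... | true = on-ℓ q (𝟙 X) (𝟙 Y)
    ... | false = off-ℓ q (𝟙 X) (𝟙 Y)
    collect : ∀ k q x y → (+ 1 + k) * y + (q * x - y) ≡ k * y + q * x
    collect = solve-∀

  localSum-distinct : ∀ q ℓ m → ℓ < M → m < M → m ≢ ℓ → LocalSum q ℓ m (q + + M-1 - + 1) (+ 1)
  localSum-distinct q ℓ m ℓ<M m<M m≢ℓ t a = begin
    ∑[ e ← upTo M ] (differenceFactor q ℓ e * 𝟙 (if e ≡ᵇ m then X else Y))
      ≡⟨ ∑-cong (upTo M) pointwise ⟩
    ∑[ e ← upTo M ] (𝟙 Y + (𝟙 (e ≡ᵇ ℓ) * D₁ + 𝟙 (e ≡ᵇ m) * D₂))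
      ≡⟨ ∑-+ (upTo M) (λ _ → 𝟙 Y) (λ e → 𝟙 (e ≡ᵇ ℓ) * D₁ + 𝟙 (e ≡ᵇ m) * D₂) ⟩
    ∑[ _ ← upTo M ] 𝟙 Y + ∑[ e ← upTo M ] (𝟙 (e ≡ᵇ ℓ) * D₁ + 𝟙 (e ≡ᵇ m) * D₂)
      ≡⟨ cong (_+_ (∑[ _ ← upTo M ] 𝟙 Y)) (∑-+ (upTo M) (λ e → 𝟙 (e ≡ᵇ ℓ) * D₁) (λ e → 𝟙 (e ≡ᵇ m) * D₂)) ⟩
    ∑[ _ ← upTo M ] 𝟙 Y + (∑[ e ← upTo M ] (𝟙 (e ≡ᵇ ℓ) * D₁) + ∑[ e ← upTo M ] (𝟙 (e ≡ᵇ m) * D₂))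
      ≡⟨ cong₂ _+_ (∑-upTo-const M (𝟙 Y)) (cong₂ _+_ (∑-upTo-𝟙≡-const ℓ D₁ ℓ<M) (∑-upTo-𝟙≡-const m D₂ m<M)) ⟩
    (+ 1 + + M-1) * 𝟙 Y + (D₁ + D₂)
      ≡⟨ collect (+ M-1) q (𝟙 X) (𝟙 Y) ⟩
    (q + + M-1 - + 1) * 𝟙 Y + + 1 * 𝟙 X ∎
    where
    open ≡-Reasoning
    X = t <ᵇ a
    Y = t ≤ᵇ a
    D₁ = (q - + 1) * 𝟙 Y
    D₂ = 𝟙 X - 𝟙 Y
    on-ℓ : ∀ q x y → q * y ≡ y + (+ 1 * ((q - + 1) * y) + + 0 * (x - y))
    on-ℓ = solve-∀
    on-m : ∀ q x y → + 1 * x ≡ y + (+ 0 * ((q - + 1) * y) + + 1 * (x - y))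
    on-m = solve-∀
    elsewhere : ∀ q x y → + 1 * y ≡ y + (+ 0 * ((q - + 1) * y) + + 0 * (x - y))
    elsewhere = solve-∀
    pointwise : ∀ e → differenceFactor q ℓ e * 𝟙 (if e ≡ᵇ m then X else Y) ≡ 𝟙 Y + (𝟙 (e ≡ᵇ ℓ) * D₁ + 𝟙 (e ≡ᵇ m) * D₂)
    pointwise e with e ≡ᵇ ℓ in e≡ᵇℓ | e ≡ᵇ m in e≡ᵇm
    ... | true | true = ⊥-elim (m≢ℓ (trans (sym (≡ᵇ≡true⇒≡ {e} e≡ᵇm)) (≡ᵇ≡true⇒≡ {e} e≡ᵇℓ)))
    ... | true | false = on-ℓ q (𝟙 X) (𝟙 Y)
    ... | false | true = on-m q (𝟙 X) (𝟙 Y)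
    ... | false | false = elsewhere q (𝟙 X) (𝟙 Y)
    collect : ∀ k q x y → (+ 1 + k) * y + ((q - + 1) * y + (x - y)) ≡ (q + k - + 1) * y + + 1 * x
    collect = solve-∀

  module _ (q : ℤ) (ℓ k : ℕ) (β γ : ℤ) (local : LocalSum q ℓ k β γ) where

    qPower : List ℕ → ℤ
    qPower d = q ^ count (map (_≡ᵇ ℓ) d)

    weight : List ℕ → List ℕ → ℤ
    weight d b = qPower d * 𝟙 (admissible (map (_≡ᵇ k) d) b)

    ∑-words-weight : ∀ l t b → length b ≡ l → ∑[ d ← words l M ] weight d (t ∷ b) ≡ chainWeight β γ t b
    ∑-words-weight zero t [] _ = refl
    ∑-words-weight (suc l) t (a ∷ b) len = begin
      ∑[ d ← words (suc l) M ] weight d (t ∷ a ∷ b)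
        ≡⟨ ∑-words l M _ ⟩
      ∑[ e ← upTo M ] ∑[ d ← words l M ] weight (e ∷ d) (t ∷ a ∷ b)
        ≡⟨ ∑-cong (upTo M) (λ e → trans (∑-cong (words l M) (factor e)) (sym (∑-*ˡ (words l M) (localFactor e) _))) ⟩
      ∑[ e ← upTo M ] (localFactor e * ∑[ d ← words l M ] weight d (a ∷ b))
        ≡⟨ ∑-cong (upTo M) (λ e → cong (localFactor e *_) (∑-words-weight l a b (ℕₚ.suc-injective len))) ⟩
      ∑[ e ← upTo M ] (localFactor e * chainWeight β γ a b)
        ≡⟨ ∑-*ʳ (upTo M) (chainWeight β γ a b) localFactor ⟨
      ∑ (upTo M) localFactor * chainWeight β γ a b
        ≡⟨ cong (_* chainWeight β γ a b) (local t a) ⟩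
      chainWeight β γ t (a ∷ b) ∎
      where
      open ≡-Reasoning
      condition : ℕ → Bool
      condition e = if e ≡ᵇ k then t <ᵇ a else t ≤ᵇ a
      localFactor : ℕ → ℤ
      localFactor e = differenceFactor q ℓ e * 𝟙 (condition e)
      qPower-cons : ∀ e d → qPower (e ∷ d) ≡ differenceFactor q ℓ e * qPower d
      qPower-cons e d with e ≡ᵇ ℓ
      ... | true = refl
      ... | false = sym (ℤₚ.*-identityˡ _)
      interchange : ∀ f p i j → f * p * (i * j) ≡ f * i * (p * j)
      interchange = solve-∀
      factor : ∀ e d → weight (e ∷ d) (t ∷ a ∷ b) ≡ localFactor e * weight d (a ∷ b)
      factor e d = trans (cong₂ _*_ (qPower-cons e d) (𝟙-∧ (condition e) (admissible (map (_≡ᵇ k) d) (a ∷ b))))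
        (interchange (differenceFactor q ℓ e) (qPower d) (𝟙 (condition e)) _)

    ∑-words-F : ∀ N x → ∑[ d ← words M M ] (qPower d * F (suc M) (map (_≡ᵇ k) d) N x)
                        ≡ ∑[ b ← seqs (suc M) N ] (mono x b * wordWeight β γ b)
    ∑-words-F N x = begin
      ∑[ d ← words M M ] (qPower d * F (suc M) (map (_≡ᵇ k) d) N x)
        ≡⟨ ∑-cong (words M M) expandF ⟩
      ∑[ d ← words M M ] ∑[ b ← seqs (suc M) N ] (mono x b * weight d b)
        ≡⟨ ∑-comm (words M M) (seqs (suc M) N) _ ⟩
      ∑[ b ← seqs (suc M) N ] ∑[ d ← words M M ] (mono x b * weight d b)
        ≡⟨ ∑-cong (seqs (suc M) N) (λ b → ∑-*ˡ (words M M) (mono x b) (λ d → weight d b)) ⟨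
      ∑[ b ← seqs (suc M) N ] (mono x b * ∑[ d ← words M M ] weight d b)
        ≡⟨ ∑-seqs-cong (suc M) N (λ { (t ∷ b) len → cong (mono x (t ∷ b) *_) (∑-words-weight M t b (ℕₚ.suc-injective len)) }) ⟩
      ∑[ b ← seqs (suc M) N ] (mono x b * wordWeight β γ b) ∎
      where
      open ≡-Reasoning
      monomialFirst : ∀ p i m → p * (i * m) ≡ m * (p * i)
      monomialFirst = solve-∀
      expandF : ∀ d → qPower d * F (suc M) (map (_≡ᵇ k) d) N x ≡ ∑[ b ← seqs (suc M) N ] (mono x b * weight d b)
      expandF d = begin
        qPower d * F (suc M) (map (_≡ᵇ k) d) N x
          ≡⟨ cong (qPower d *_) (∑-filter (admissible (map (_≡ᵇ k) d)) (seqs (suc M) N) (mono x)) ⟩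
        qPower d * ∑[ b ← seqs (suc M) N ] (𝟙 (admissible (map (_≡ᵇ k) d) b) * mono x b)
          ≡⟨ ∑-*ˡ (seqs (suc M) N) (qPower d) _ ⟩
        ∑[ b ← seqs (suc M) N ] (qPower d * (𝟙 (admissible (map (_≡ᵇ k) d) b) * mono x b))
          ≡⟨ ∑-cong (seqs (suc M) N) (λ b → monomialFirst (qPower d) _ (mono x b)) ⟩
        ∑[ b ← seqs (suc M) N ] (mono x b * weight d b) ∎

    ∑-PPF-weighted : ℓ < M → k < M → ∀ N x →
      ∑[ π ← PPF (suc M) ] (q ^ Δf (suc M) ℓ π * F (suc M) (Set[ suc M ] k π) N x)
        ≡ ∑[ b ← seqs (suc M) N ] (mono x b * wordWeight β γ b)
    ∑-PPF-weighted ℓ<M k<M N x = trans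
      (∑-PPF-differences _ (λ d → qPower d * F (suc M) (map (_≡ᵇ k) d) N x) (λ c d c<M d<M →
        cong₂ (λ L L′ → q ^ count L * F (suc M) L′ N x) (diffList-walk ℓ c d ℓ<M d<M) (diffList-walk k c d k<M d<M)))
      (∑-words-F N x)

theorem1p6 : (n m ℓ : ℕ) → 2 ≤ n → m ≤ n ∸ 2 → ℓ ≤ n ∸ 2 → m ≢ ℓ →
    (N : ℕ) (x : ℕ → ℤ) (q : ℤ) →
      (sumℤ (map (λ π → (q ^ Δf n ℓ π) * F n (Set[ n ] ℓ π) N x) (PPF n))
        ≡ sumOneTo n (λ i → (q ^ (n ∸ i)) * (((+ (n ∸ 2)) ^ (i ∸ 1)) * schur (hook n i) N x)))
      × (sumℤ (map (λ π → (q ^ Δf n ℓ π) * F n (Set[ n ] m π) N x) (PPF n))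
        ≡ sumOneTo n (λ i → (((q + + n) - + 3) ^ (i ∸ 1)) * schur (hook n i) N x))
theorem1p6 (suc zero) _ _ (s≤s ()) _ _ _ _ _ _
theorem1p6 (suc (suc M-1)) m ℓ _ m≤M-1 ℓ≤M-1 m≢ℓ N x q =
  trans (∑-PPF-weighted q ℓ ℓ (+ M-1) q (localSum-same q ℓ ℓ<M) ℓ<M ℓ<M N x) (hookExpansion (+ M-1) q M) ,
  trans (∑-PPF-weighted q ℓ m β (+ 1) (localSum-distinct q ℓ m ℓ<M m<M m≢ℓ) ℓ<M m<M N x)
    (trans (hookExpansion β (+ 1) M) (∑-cong (oneTo (suc M)) simplify))
  where
  open DifferenceWords M-1
  open HookExpansion N x using (hookExpansion)
  M = suc M-1
  ℓ<M = s≤s ℓ≤M-1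
  m<M = s≤s m≤M-1
  β = q + + M-1 - + 1
  β≡q+n-3 : ∀ q k → q + k - + 1 ≡ q + (+ 2 + k) - + 3
  β≡q+n-3 = solve-∀
  simplify : ∀ i → (+ 1) ^ (suc M ∸ i) * (β ^ (i ∸ 1) * schur (hook (suc M) i) N x)
                   ≡ ((q + + suc M) - + 3) ^ (i ∸ 1) * schur (hook (suc M) i) N x
  simplify i = trans (cong (_* (β ^ (i ∸ 1) * schur (hook (suc M) i) N x)) (ℤₚ.^-zeroˡ (suc M ∸ i)))
    (trans (ℤₚ.*-identityˡ _) (cong (λ b → b ^ (i ∸ 1) * schur (hook (suc M) i) N x) (β≡q+n-3 q (+ M-1))))
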